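{- Let $G$ be a finite simple bipartite graph of order $2n$ with a perfect matching, and suppose $f(G)=k$ where $0\leq k\leq n-1$. Then $$e(G)\leq \frac{(n-k)(n+k+1)}{2}+nk,$$ and equality holds if and only if $G$ is isomorphic to $H_{n,k}$.
   Context: For a graph $G$ with a perfect matching $M$, a subset $S\subseteq M$ is a forcing set of $M$ if $S$ is contained in no perfect matching of $G$ other than $M$. $f(G,M)$ is the minimum size of a forcing set of $M$, and $f(G)=\min_M f(G,M)$ over all perfect matchings $M$. $e(G)$ is the number of edges. For integers $0\leq k\leq n-1$, $H_{n,k}$ is the bipartite graph with parts $U=\{u_1,\dots,u_n\}$ and $V=\{v_1,\dots,v_n\}$ in which $u_iv_j$ (for $1\le i,j\le n$) is a non-edge if and only if $1\leq i<j\leq n-k$ (all other pairs $u_iv_j$ are edges). -}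

module Defs where

open import Data.Bool using (Bool; true; false; _∧_; not)
open import Data.Nat using (ℕ; _<_; _<ᵇ_; _≤_)
open import Data.Fin using (Fin; toℕ; splitAt)
open import Data.Fin.Properties using (_≟_)
open import Data.List using (List; length; filter; allFin; cartesianProduct)
open import Data.Nat.Properties using (_<?_)
open import Data.Product using (Σ; _×_; _,_; proj₁; proj₂; ∃)
open import Data.Sum using (inj₁; inj₂)
open import Relation.Binary.PropositionalEquality using (_≡_; _≢_)
open import Relation.Nullary using (¬_)
open import Relation.Nullary.Decidable using (_×-dec_)
open import Function.Bundles using (_↔_; Inverse)

record Graph (m : ℕ) : Set where
  field
    adj   : Fin m → Fin m → Bool
    sym   : ∀ x y → adj x y ≡ adj y x
    irref : ∀ x → adj x x ≡ false
open Graph public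

edgeCount : ∀ {m} → Graph m → ℕ
edgeCount {m} G =
  length (filter (λ p → (toℕ (proj₁ p) <? toℕ (proj₂ p)) ×-dec (adj G (proj₁ p) (proj₂ p) Data.Bool.≟ true))
                 (cartesianProduct (allFin m) (allFin m)))

IsBipartite : ∀ {m} → Graph m → Set
IsBipartite {m} G = Σ (Fin m → Bool) λ c → ∀ x y → adj G x y ≡ true → c x ≢ c y

-- A perfect matching, given by its mate function: a fixed-point-free involution
-- whose pairs {x, mate x} are edges of G.  The matching's edge set is {{x, mate x}}.
record PerfectMatching {m : ℕ} (G : Graph m) : Set where
  field
    mate     : Fin m → Fin m
    invol    : ∀ x → mate (mate x) ≡ x
    noFix    : ∀ x → mate x ≢ x
    isEdge   : ∀ x → adj G x (mate x) ≡ true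
open PerfectMatching public

-- A subset S of the edges of a perfect matching M, encoded by the set of vertices
-- covered by S (closed under mate).
record EdgeSubset {m : ℕ} {G : Graph m} (M : PerfectMatching G) : Set where
  field
    mem    : Fin m → Bool
    closed : ∀ x → mem x ≡ mem (mate M x)
open EdgeSubset public

subsetSize : ∀ {m} {G : Graph m} {M : PerfectMatching G} → EdgeSubset M → ℕ
subsetSize {m} {G} {M} S =
  length (filter (λ x → (mem S x Data.Bool.≟ true) ×-dec (toℕ x <? toℕ (mate M x))) (allFin m))

ContainedIn : ∀ {m} {G : Graph m} {M : PerfectMatching G} → EdgeSubset M → PerfectMatching G → Set
ContainedIn {M = M} S M' = ∀ x → mem S x ≡ true → mate M' x ≡ mate M x

IsForcingSet : ∀ {m} {G : Graph m} (M : PerfectMatching G) → EdgeSubset M → Set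
IsForcingSet {m} {G} M S = (M' : PerfectMatching G) → ContainedIn S M' → ∀ x → mate M' x ≡ mate M x

ForcingNumberIs : ∀ {m} → Graph m → ℕ → Set
ForcingNumberIs G k =
  (Σ (PerfectMatching G) λ M → Σ (EdgeSubset M) λ S → IsForcingSet M S × subsetSize S ≡ k)
  × (∀ (M : PerfectMatching G) (S : EdgeSubset M) → IsForcingSet M S → k ≤ subsetSize S)

Isomorphic : ∀ {m} → Graph m → Graph m → Set
Isomorphic {m} G H = Σ (Fin m ↔ Fin m) λ φ → ∀ x y → adj G x y ≡ adj H (Inverse.to φ x) (Inverse.to φ y)

-- H_{n,k} on Fin (n + n): vertex inject i is u_{i+1}, vertex (n + j) is v_{j+1}.
-- u_{i+1} v_{j+1} is a non-edge iff 1 ≤ i+1 < j+1 ≤ n-k, i.e. i < j and j < n ∸ k (0-based).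
Hadj : (n k : ℕ) → Fin (n Data.Nat.+ n) → Fin (n Data.Nat.+ n) → Bool
Hadj n k x y with splitAt n x | splitAt n y
... | inj₁ i | inj₂ j = not ((toℕ i <ᵇ toℕ j) ∧ (toℕ j <ᵇ (n Data.Nat.∸ k)))
... | inj₂ j | inj₁ i = not ((toℕ i <ᵇ toℕ j) ∧ (toℕ j <ᵇ (n Data.Nat.∸ k)))
... | inj₁ _ | inj₁ _ = false
... | inj₂ _ | inj₂ _ = false

private
  Hsym : ∀ n k x y → Hadj n k x y ≡ Hadj n k y x
  Hsym n k x y with splitAt n x | splitAt n y
  ... | inj₁ i | inj₂ j = Relation.Binary.PropositionalEquality.refl
  ... | inj₂ j | inj₁ i = Relation.Binary.PropositionalEquality.refl
  ... | inj₁ _ | inj₁ _ = Relation.Binary.PropositionalEquality.refl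
  ... | inj₂ _ | inj₂ _ = Relation.Binary.PropositionalEquality.refl

  Hirr : ∀ n k x → Hadj n k x x ≡ false
  Hirr n k x with splitAt n x
  ... | inj₁ _ = Relation.Binary.PropositionalEquality.refl
  ... | inj₂ _ = Relation.Binary.PropositionalEquality.refl

H : (n k : ℕ) → Graph (n Data.Nat.+ n)
H n k = record { adj = Hadj n k ; sym = Hsym n k ; irref = Hirr n k }

-- Let U, V be the colour classes, μ the mate function of a perfect matching M with a forcing set S of size k,
-- and call a vertex free if S does not cover it; U has n − k free vertices. Put an arc x → y when x is adjacent
-- to μ y: arcs stay inside a class and every vertex has a loop. If free vertices of U formed a directed cycle,
-- re-matching each of them to the partner of its successor would give a second perfect matching containing S.
-- So for distinct x, y in one class, [x → y] + [y → x] + [x and y are free] ≤ 2, and summing over all pairs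
-- of U (the diagonal contributes 2 + [x free]) gives 2e(G) + (n − k)² ≤ 2n² + (n − k), which is the bound.
-- At equality every pair is tight: the free vertices of U span a tournament without 3-cycles, hence a
-- transitive one, and all other pairs are arcs; ranking the free vertices by this order and placing the forced
-- ones after them is an isomorphism onto H n k. Conversely, H n k is tight for every pair.

module Submission where

open import Defs
open import Data.Bool as Bool using (Bool; true; false; not; _∧_; if_then_else_; T)
import Data.Bool.Properties as BoolP
open import Data.Empty using (⊥; ⊥-elim)
open import Data.Fin as Fin using (Fin; toℕ; _↑ˡ_; _↑ʳ_; splitAt)
import Data.Fin.Properties as FinP
open import Data.Fin.Permutation as Perm using (Permutation; _⟨$⟩ʳ_; _⟨$⟩ˡ_)
open import Data.List as List using (length; filter; tabulate; cartesianProductWith)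
import Data.List.Properties as ListP
open import Data.Nat as ℕ using (ℕ; zero; suc; _+_; _*_; _∸_; _≤_; _<_; z≤n; s≤s; _<ᵇ_)
import Data.Nat.Properties as ℕP
open import Data.Nat.Tactic.RingSolver using (solve-∀)
open import Data.Product using (Σ; _×_; _,_; proj₁; proj₂)
open import Data.Sum using (_⊎_; inj₁; inj₂; [_,_]′)
open import Function using (_∘_; id)
open import Function.Bundles using (_⇔_; mk⇔)
open import Relation.Binary.Definitions using (tri<; tri≈; tri>)
open import Relation.Binary.PropositionalEquality as ≡
  using (_≡_; _≢_; refl; cong; cong₂; subst; subst₂; module ≡-Reasoning)
open import Relation.Nullary using (yes; no; does; ¬_)
open import Relation.Nullary.Decidable using (_×-dec_; dec-true; dec-false)
open import Relation.Unary using (Pred; Decidable)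

open import Algebra.Properties.Semiring.Sum ℕP.+-*-semiring
  using (sum; sum-cong-≗; ∑-distrib-+; ∑-comm; sum-permute; *-distribˡ-sum)

⟦_⟧ : Bool → ℕ
⟦ true ⟧ = 1
⟦ false ⟧ = 0

⟦⟧≤1 : ∀ b → ⟦ b ⟧ ≤ 1
⟦⟧≤1 true = ℕP.≤-refl
⟦⟧≤1 false = z≤n

⟦⟧-mono : ∀ {a b} → (a ≡ true → b ≡ true) → ⟦ a ⟧ ≤ ⟦ b ⟧
⟦⟧-mono {true} a⇒b rewrite a⇒b refl = ℕP.≤-refl
⟦⟧-mono {false} _ = z≤n

⟦⟧-+-not : ∀ a → ⟦ a ⟧ + ⟦ not a ⟧ ≡ 1
⟦⟧-+-not true = refl
⟦⟧-+-not false = refl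

⟦∧⟧ : ∀ a b → ⟦ a ∧ b ⟧ ≡ ⟦ a ⟧ * ⟦ b ⟧
⟦∧⟧ true b = ≡.sym (ℕP.+-identityʳ ⟦ b ⟧)
⟦∧⟧ false b = refl

⟦≟⟧ : ∀ a b → ⟦ does (a Bool.≟ b) ⟧ ≡ ⟦ a ⟧ * ⟦ b ⟧ + ⟦ not a ⟧ * ⟦ not b ⟧
⟦≟⟧ true true = refl
⟦≟⟧ true false = refl
⟦≟⟧ false true = refl
⟦≟⟧ false false = refl

⟦⟧-split : ∀ a s → ⟦ s ⟧ ≡ ⟦ a ∧ s ⟧ + ⟦ not a ∧ s ⟧
⟦⟧-split true s = ≡.sym (ℕP.+-identityʳ ⟦ s ⟧)
⟦⟧-split false s = refl

does-≟-true : ∀ b → does (b Bool.≟ true) ≡ b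
does-≟-true true = refl
does-≟-true false = refl

∧-intro : ∀ {a b} → a ≡ true → b ≡ true → (a ∧ b) ≡ true
∧-intro refl refl = refl

∧-elim : ∀ a {b} → (a ∧ b) ≡ true → a ≡ true × b ≡ true
∧-elim true b≡true = refl , b≡true

⟦∧⟧≤⟦⟧ : ∀ a b → ⟦ a ∧ b ⟧ ≤ ⟦ a ⟧
⟦∧⟧≤⟦⟧ true b = ⟦⟧≤1 b
⟦∧⟧≤⟦⟧ false b = z≤n

⟦∧⟧<⟦⟧ : ∀ {a b} → a ≡ true → b ≡ false → ⟦ a ∧ b ⟧ < ⟦ a ⟧
⟦∧⟧<⟦⟧ refl refl = s≤s z≤n

⟦∧⟧<⟦∧⟧ : ∀ {a b c} → a ≡ true → b ≡ false → c ≡ true → ⟦ a ∧ b ⟧ < ⟦ a ∧ c ⟧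
⟦∧⟧<⟦∧⟧ refl refl refl = s≤s z≤n

at-most-two : ∀ {a b c s} → (a ≡ true → s ≡ true) → (b ≡ true → s ≡ true) → (c ≡ true → s ≡ true) →
              (a ≡ true → b ≡ true → c ≡ true → ⊥) → ⟦ a ⟧ + ⟦ b ⟧ + ⟦ c ⟧ ≤ 2 * ⟦ s ⟧
at-most-two {s = false} a⇒s b⇒s c⇒s _ = ℕP.+-mono-≤ (ℕP.+-mono-≤ (⟦⟧-mono a⇒s) (⟦⟧-mono b⇒s)) (⟦⟧-mono c⇒s)
at-most-two {true} {true} {true} {true} _ _ _ ¬abc = ⊥-elim (¬abc refl refl refl)
at-most-two {true} {true} {false} {true} _ _ _ _ = ℕP.≤-refl
at-most-two {true} {false} {c} {true} _ _ _ _ = s≤s (⟦⟧≤1 c)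
at-most-two {false} {b} {c} {true} _ _ _ _ = ℕP.+-mono-≤ (⟦⟧≤1 b) (⟦⟧≤1 c)

exactly-two-of-two : ∀ a b → ⟦ a ⟧ + ⟦ b ⟧ + ⟦ false ⟧ ≡ 2 → a ≡ true
exactly-two-of-two true _ _ = refl
exactly-two-of-two false true ()
exactly-two-of-two false false ()

exactly-one-of-two : ∀ a b → ⟦ a ⟧ + ⟦ b ⟧ + ⟦ true ⟧ ≡ 2 → a ≡ not b
exactly-one-of-two true false _ = refl
exactly-one-of-two false true _ = refl
exactly-one-of-two true true ()
exactly-one-of-two false false ()

by-cases : ∀ {p} {P : Set p} b → (b ≡ true → P) → (b ≡ false → P) → P
by-cases true t _ = t refl
by-cases false _ f = f refl

<ᵇ-true : ∀ {a b} → a < b → (a <ᵇ b) ≡ true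
<ᵇ-true {a} {b} = dec-true (a ℕP.<? b)

<ᵇ-true⁻¹ : ∀ {a b} → (a <ᵇ b) ≡ true → a < b
<ᵇ-true⁻¹ {a} {b} a<ᵇb = ℕP.<ᵇ⇒< a b (subst T (≡.sym a<ᵇb) _)

<ᵇ-false : ∀ {a b} → ¬ a < b → (a <ᵇ b) ≡ false
<ᵇ-false {a} {b} = dec-false (a ℕP.<? b)

sum-mono-≤ : ∀ {m} {f g : Fin m → ℕ} → (∀ x → f x ≤ g x) → sum f ≤ sum g
sum-mono-≤ {zero} _ = z≤n
sum-mono-≤ {suc m} f≤g = ℕP.+-mono-≤ (f≤g Fin.zero) (sum-mono-≤ (f≤g ∘ Fin.suc))

sum-mono-< : ∀ {m} {f g : Fin m → ℕ} → (∀ x → f x ≤ g x) → ∀ z → f z < g z → sum f < sum g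
sum-mono-< {suc m} f≤g Fin.zero lt = ℕP.+-mono-<-≤ lt (sum-mono-≤ (f≤g ∘ Fin.suc))
sum-mono-< {suc m} f≤g (Fin.suc z) lt = ℕP.+-mono-≤-< (f≤g Fin.zero) (sum-mono-< (f≤g ∘ Fin.suc) z lt)

sum-≤-antisym : ∀ {m} {f g : Fin m → ℕ} → (∀ x → f x ≤ g x) → sum g ≤ sum f → ∀ x → f x ≡ g x
sum-≤-antisym {f = f} {g} f≤g Σg≤Σf x with ℕP.m≤n⇒m<n∨m≡n (f≤g x)
... | inj₂ fx≡gx = fx≡gx
... | inj₁ fx<gx = ⊥-elim (ℕP.<⇒≱ (sum-mono-< f≤g x fx<gx) Σg≤Σf)

sum-const : ∀ {m} c → sum {m} (λ _ → c) ≡ m * c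
sum-const {zero} c = refl
sum-const {suc m} c = cong (c +_) (sum-const {m} c)

sum-zero : ∀ {m} → sum {m} (λ _ → 0) ≡ 0
sum-zero {m} = ≡.trans (sum-const {m} 0) (ℕP.*-zeroʳ m)

sum-one : ∀ {m} → sum {m} (λ _ → 1) ≡ m
sum-one {m} = ≡.trans (sum-const {m} 1) (ℕP.*-identityʳ m)

sum-↑ : ∀ n {n′} (f : Fin (n + n′) → ℕ) → sum f ≡ sum (λ i → f (i ↑ˡ n′)) + sum (λ j → f (n ↑ʳ j))
sum-↑ zero f = refl
sum-↑ (suc n) f = ≡.trans (cong (f Fin.zero +_) (sum-↑ n (f ∘ Fin.suc))) (≡.sym (ℕP.+-assoc (f Fin.zero) _ _))

_==_ : ∀ {m} → Fin m → Fin m → Bool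
x == y = does (x FinP.≟ y)

==-refl : ∀ {m} (x : Fin m) → (x == x) ≡ true
==-refl x = dec-true (x FinP.≟ x) refl

sum-== : ∀ {m} (x : Fin m) → sum (λ y → ⟦ x == y ⟧) ≡ 1
sum-== {suc m} Fin.zero =
  cong suc (≡.trans (sum-cong-≗ {m} {λ y → ⟦ Fin.zero == Fin.suc y ⟧} (λ y → refl)) (sum-zero {m}))
sum-== {suc m} (Fin.suc x) = ≡.trans (sum-cong-≗ (λ y → cong ⟦_⟧ (suc==suc y))) (sum-== x)
  where
  suc==suc : ∀ y → (Fin.suc x == Fin.suc y) ≡ (x == y)
  suc==suc y with x FinP.≟ y
  ... | yes _ = refl
  ... | no _ = refl

sum² : ∀ {m} → (Fin m → Fin m → ℕ) → ℕ
sum² f = sum λ x → sum (f x)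

sum²-cong : ∀ {m} {f g : Fin m → Fin m → ℕ} → (∀ x y → f x y ≡ g x y) → sum² f ≡ sum² g
sum²-cong f≡g = sum-cong-≗ (λ x → sum-cong-≗ (f≡g x))

sum²-mono-≤ : ∀ {m} {f g : Fin m → Fin m → ℕ} → (∀ x y → f x y ≤ g x y) → sum² f ≤ sum² g
sum²-mono-≤ f≤g = sum-mono-≤ (λ x → sum-mono-≤ (f≤g x))

sum²-≤-antisym : ∀ {m} {f g : Fin m → Fin m → ℕ} → (∀ x y → f x y ≤ g x y) → sum² g ≤ sum² f →
                 ∀ x y → f x y ≡ g x y
sum²-≤-antisym f≤g Σg≤Σf x =
  sum-≤-antisym (f≤g x) (ℕP.≤-reflexive (≡.sym (sum-≤-antisym (λ x → sum-mono-≤ (f≤g x)) Σg≤Σf x)))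

sum²-+ : ∀ {m} (f g : Fin m → Fin m → ℕ) → sum² (λ x y → f x y + g x y) ≡ sum² f + sum² g
sum²-+ f g = ≡.trans (sum-cong-≗ (λ x → ∑-distrib-+ (f x) (g x))) (∑-distrib-+ (λ x → sum (f x)) (λ x → sum (g x)))

sum²-transpose : ∀ {m} (f : Fin m → Fin m → ℕ) → sum² (λ x y → f y x) ≡ sum² f
sum²-transpose f = ∑-comm (λ x y → f y x)

sum²-permuteʳ : ∀ {m} (f : Fin m → Fin m → ℕ) (π : Permutation m m) → sum² (λ x y → f x (π ⟨$⟩ʳ y)) ≡ sum² f
sum²-permuteʳ f π = ≡.sym (sum-cong-≗ (λ x → sum-permute (f x) π))

sum²-* : ∀ {m} (f g : Fin m → ℕ) → sum² (λ x y → f x * g y) ≡ sum f * sum g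
sum²-* f g = begin
  sum (λ x → sum (λ y → f x * g y))  ≡⟨ sum-cong-≗ (λ x → ≡.sym (*-distribˡ-sum (f x) g)) ⟩
  sum (λ x → f x * sum g)            ≡⟨ sum-cong-≗ (λ x → ℕP.*-comm (f x) (sum g)) ⟩
  sum (λ x → sum g * f x)            ≡⟨ ≡.sym (*-distribˡ-sum (sum g) f) ⟩
  sum g * sum f                      ≡⟨ ℕP.*-comm (sum g) (sum f) ⟩
  sum f * sum g                      ∎
  where open ≡-Reasoning

sum²-diagonal : ∀ {m} (f : Fin m → ℕ) → sum² (λ x y → f x * ⟦ x == y ⟧) ≡ sum f
sum²-diagonal f = sum-cong-≗ λ x → begin
  sum (λ y → f x * ⟦ x == y ⟧)  ≡⟨ ≡.sym (*-distribˡ-sum (f x) (λ y → ⟦ x == y ⟧)) ⟩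
  f x * sum (λ y → ⟦ x == y ⟧)  ≡⟨ cong (f x *_) (sum-== x) ⟩
  f x * 1                       ≡⟨ ℕP.*-identityʳ (f x) ⟩
  f x                           ∎
  where open ≡-Reasoning

length-filter-tabulate : ∀ {a p} {A : Set a} {P : Pred A p} (P? : Decidable P) {m} (f : Fin m → A) →
                         length (filter P? (tabulate f)) ≡ sum (λ i → ⟦ does (P? (f i)) ⟧)
length-filter-tabulate P? {zero} f = refl
length-filter-tabulate P? {suc m} f with does (P? (f Fin.zero))
... | true = cong suc (length-filter-tabulate P? (f ∘ Fin.suc))
... | false = length-filter-tabulate P? (f ∘ Fin.suc)

length-filter-allPairs : ∀ {p} {m} {P : Pred (Fin m × Fin m) p} (P? : Decidable P) →
  length (filter P? (List.cartesianProduct (List.allFin m) (List.allFin m)))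
    ≡ sum² (λ x y → ⟦ does (P? (x , y)) ⟧)
length-filter-allPairs {m = m} P? = rows id
  where
  rows : ∀ {l} (g : Fin l → Fin m) →
         length (filter P? (cartesianProductWith _,_ (tabulate g) (List.allFin m)))
           ≡ sum (λ i → sum (λ y → ⟦ does (P? (g i , y)) ⟧))
  rows {zero} g = refl
  rows {suc l} g = begin
    length (filter P? (row List.++ rest))
      ≡⟨ cong length (ListP.filter-++ P? row rest) ⟩
    length (filter P? row List.++ filter P? rest)
      ≡⟨ ListP.length-++ (filter P? row) ⟩
    length (filter P? row) + length (filter P? rest)
      ≡⟨ cong₂ _+_ (≡.trans (cong (length ∘ filter P?) (ListP.map-tabulate id (g Fin.zero ,_)))
                            (length-filter-tabulate P? (g Fin.zero ,_)))
                   (rows (g ∘ Fin.suc)) ⟩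
    sum (λ y → ⟦ does (P? (g Fin.zero , y)) ⟧) + sum (λ i → sum (λ y → ⟦ does (P? (g (Fin.suc i) , y)) ⟧)) ∎
    where
    open ≡-Reasoning
    row = List.map (g Fin.zero ,_) (List.allFin m)
    rest = cartesianProductWith _,_ (tabulate (g ∘ Fin.suc)) (List.allFin m)

adjacencySum : ∀ {m} → Graph m → ℕ
adjacencySum G = sum² (λ x y → ⟦ adj G x y ⟧)

module _ {m : ℕ} (G : Graph m) where

  private
    _≺_ : Fin m → Fin m → Bool
    x ≺ y = does (toℕ x ℕP.<? toℕ y)

    ⟦≺⟧+⟦≻⟧ : ∀ x y → ⟦ x ≺ y ∧ adj G x y ⟧ + ⟦ y ≺ x ∧ adj G y x ⟧ ≡ ⟦ adj G x y ⟧
    ⟦≺⟧+⟦≻⟧ x y with ℕP.<-cmp (toℕ x) (toℕ y)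
    ... | tri< x<y _ y≮x
      rewrite dec-true (toℕ x ℕP.<? toℕ y) x<y | dec-false (toℕ y ℕP.<? toℕ x) y≮x = ℕP.+-identityʳ _
    ... | tri> x≮y _ y<x
      rewrite dec-false (toℕ x ℕP.<? toℕ y) x≮y | dec-true (toℕ y ℕP.<? toℕ x) y<x = cong ⟦_⟧ (Graph.sym G y x)
    ... | tri≈ x≮y x≡y _
      rewrite FinP.toℕ-injective x≡y | dec-false (toℕ y ℕP.<? toℕ y) x≮y | irref G y = refl

  2*edgeCount≡adjacencySum : 2 * edgeCount G ≡ adjacencySum G
  2*edgeCount≡adjacencySum = begin
    2 * edgeCount G
      ≡⟨ cong (2 *_) (length-filter-allPairs
           (λ p → (toℕ (proj₁ p) ℕP.<? toℕ (proj₂ p)) ×-dec (adj G (proj₁ p) (proj₂ p) Bool.≟ true))) ⟩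
    2 * sum² (λ x y → ⟦ x ≺ y ∧ does (adj G x y Bool.≟ true) ⟧)
      ≡⟨ cong (2 *_) (sum²-cong (λ x y → cong (λ b → ⟦ x ≺ y ∧ b ⟧) (does-≟-true (adj G x y)))) ⟩
    2 * sum² below
      ≡⟨ cong (sum² below +_) (ℕP.+-identityʳ _) ⟩
    sum² below + sum² below
      ≡⟨ cong (sum² below +_) (≡.sym (sum²-transpose below)) ⟩
    sum² below + sum² (λ x y → below y x)
      ≡⟨ ≡.sym (sum²-+ below (λ x y → below y x)) ⟩
    sum² (λ x y → below x y + below y x)
      ≡⟨ sum²-cong ⟦≺⟧+⟦≻⟧ ⟩
    adjacencySum G ∎
    where
    open ≡-Reasoning
    below : Fin m → Fin m → ℕ
    below x y = ⟦ x ≺ y ∧ adj G x y ⟧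

adjacencySum-cong : ∀ {m} (G H′ : Graph m) → Isomorphic G H′ → adjacencySum G ≡ adjacencySum H′
adjacencySum-cong G H′ (π , adj-preserved) = begin
  sum² (λ x y → ⟦ adj G x y ⟧)                    ≡⟨ sum²-cong (λ x y → cong ⟦_⟧ (adj-preserved x y)) ⟩
  sum² (λ x y → ⟦ adj H′ (π ⟨$⟩ʳ x) (π ⟨$⟩ʳ y) ⟧)  ≡⟨ sum²-permuteʳ (λ x y → ⟦ adj H′ (π ⟨$⟩ʳ x) y ⟧) π ⟩
  sum² (λ x y → ⟦ adj H′ (π ⟨$⟩ʳ x) y ⟧)          ≡⟨ ≡.sym (sum-permute (λ x → sum (λ y → ⟦ adj H′ x y ⟧)) π) ⟩
  adjacencySum H′                                 ∎
  where open ≡-Reasoning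

-- A double-counting identity

module PairCount {m : ℕ} (G : Graph m) (π : Permutation m m) (colour free : Fin m → Bool) where

  arc : Fin m → Fin m → Bool
  arc x y = adj G x (π ⟨$⟩ʳ y)

  sameColour : Fin m → Fin m → Bool
  sameColour x y = does (colour x Bool.≟ colour y)

  #U #V #freeU #freeV : ℕ
  #U = sum λ x → ⟦ colour x ⟧
  #V = sum λ x → ⟦ not (colour x) ⟧
  #freeU = sum λ x → ⟦ colour x ∧ free x ⟧
  #freeV = sum λ x → ⟦ not (colour x) ∧ free x ⟧

  load capacity : Fin m → Fin m → ℕ
  load x y = ⟦ arc x y ⟧ + ⟦ arc y x ⟧ + ⟦ free x ∧ free y ∧ sameColour x y ⟧
  capacity x y = 2 * ⟦ sameColour x y ⟧ + ⟦ free x ⟧ * ⟦ x == y ⟧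

  sameColour-≡ : ∀ {x y} → colour x ≡ colour y → sameColour x y ≡ true
  sameColour-≡ {x} {y} = dec-true (colour x Bool.≟ colour y)

  capacity-≢ : ∀ {x y} → x ≢ y → capacity x y ≡ 2 * ⟦ sameColour x y ⟧
  capacity-≢ {x} {y} x≢y = begin
    2 * ⟦ sameColour x y ⟧ + ⟦ free x ⟧ * ⟦ x == y ⟧
      ≡⟨ cong (λ b → 2 * ⟦ sameColour x y ⟧ + ⟦ free x ⟧ * ⟦ b ⟧) (dec-false (x FinP.≟ y) x≢y) ⟩
    2 * ⟦ sameColour x y ⟧ + ⟦ free x ⟧ * 0
      ≡⟨ cong (2 * ⟦ sameColour x y ⟧ +_) (ℕP.*-zeroʳ ⟦ free x ⟧) ⟩
    2 * ⟦ sameColour x y ⟧ + 0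
      ≡⟨ ℕP.+-identityʳ _ ⟩
    2 * ⟦ sameColour x y ⟧
      ∎
    where open ≡-Reasoning

  private
    ⟦free∧free∧same⟧ : ∀ x y → ⟦ free x ∧ free y ∧ sameColour x y ⟧
      ≡ ⟦ colour x ∧ free x ⟧ * ⟦ colour y ∧ free y ⟧ + ⟦ not (colour x) ∧ free x ⟧ * ⟦ not (colour y) ∧ free y ⟧
    ⟦free∧free∧same⟧ x y = begin
      ⟦ free x ∧ free y ∧ sameColour x y ⟧
        ≡⟨ ≡.trans (⟦∧⟧ (free x) _) (cong (⟦ free x ⟧ *_) (⟦∧⟧ (free y) _)) ⟩
      ⟦ free x ⟧ * (⟦ free y ⟧ * ⟦ sameColour x y ⟧)
        ≡⟨ cong (λ s → ⟦ free x ⟧ * (⟦ free y ⟧ * s)) (⟦≟⟧ (colour x) (colour y)) ⟩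
      ⟦ free x ⟧ * (⟦ free y ⟧ * (⟦ colour x ⟧ * ⟦ colour y ⟧ + ⟦ not (colour x) ⟧ * ⟦ not (colour y) ⟧))
        ≡⟨ regroup ⟦ free x ⟧ ⟦ free y ⟧ ⟦ colour x ⟧ ⟦ colour y ⟧ ⟦ not (colour x) ⟧ ⟦ not (colour y) ⟧ ⟩
      ⟦ colour x ⟧ * ⟦ free x ⟧ * (⟦ colour y ⟧ * ⟦ free y ⟧)
        + ⟦ not (colour x) ⟧ * ⟦ free x ⟧ * (⟦ not (colour y) ⟧ * ⟦ free y ⟧)
        ≡⟨ ≡.sym (cong₂ _+_ (cong₂ _*_ (⟦∧⟧ (colour x) _) (⟦∧⟧ (colour y) _))
                           (cong₂ _*_ (⟦∧⟧ (not (colour x)) _) (⟦∧⟧ (not (colour y)) _))) ⟩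
      ⟦ colour x ∧ free x ⟧ * ⟦ colour y ∧ free y ⟧ + ⟦ not (colour x) ∧ free x ⟧ * ⟦ not (colour y) ∧ free y ⟧ ∎
      where
      open ≡-Reasoning
      regroup : ∀ s t c d c′ d′ → s * (t * (c * d + c′ * d′)) ≡ c * s * (d * t) + c′ * s * (d′ * t)
      regroup = solve-∀

  sum-load : sum² load ≡ 2 * adjacencySum G + (#freeU * #freeU + #freeV * #freeV)
  sum-load = begin
    sum² load
      ≡⟨ ≡.trans (sum²-+ (λ x y → out x y + into x y) both) (cong (_+ sum² both) (sum²-+ out into)) ⟩
    sum² out + sum² into + sum² both
      ≡⟨ cong₂ _+_ (cong₂ _+_ arcs (≡.trans (sum²-transpose out) arcs)) free-pairs ⟩
    adjacencySum G + adjacencySum G + (#freeU * #freeU + #freeV * #freeV)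
      ≡⟨ cong (λ s → adjacencySum G + s + (#freeU * #freeU + #freeV * #freeV)) (≡.sym (ℕP.+-identityʳ _)) ⟩
    2 * adjacencySum G + (#freeU * #freeU + #freeV * #freeV) ∎
    where
    open ≡-Reasoning
    out into both : Fin m → Fin m → ℕ
    out x y = ⟦ arc x y ⟧
    into x y = ⟦ arc y x ⟧
    both x y = ⟦ free x ∧ free y ∧ sameColour x y ⟧
    freeU freeV : Fin m → ℕ
    freeU x = ⟦ colour x ∧ free x ⟧
    freeV x = ⟦ not (colour x) ∧ free x ⟧
    arcs : sum² out ≡ adjacencySum G
    arcs = sum²-permuteʳ (λ x y → ⟦ adj G x y ⟧) π
    free-pairs : sum² both ≡ #freeU * #freeU + #freeV * #freeV
    free-pairs = begin
      sum² both
        ≡⟨ sum²-cong ⟦free∧free∧same⟧ ⟩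
      sum² (λ x y → freeU x * freeU y + freeV x * freeV y)
        ≡⟨ sum²-+ (λ x y → freeU x * freeU y) (λ x y → freeV x * freeV y) ⟩
      sum² (λ x y → freeU x * freeU y) + sum² (λ x y → freeV x * freeV y)
        ≡⟨ cong₂ _+_ (sum²-* freeU freeU) (sum²-* freeV freeV) ⟩
      #freeU * #freeU + #freeV * #freeV ∎

  #free≡#freeU+#freeV : sum (λ x → ⟦ free x ⟧) ≡ #freeU + #freeV
  #free≡#freeU+#freeV = ≡.trans (sum-cong-≗ (λ x → ⟦⟧-split (colour x) (free x)))
                                (∑-distrib-+ (λ x → ⟦ colour x ∧ free x ⟧) (λ x → ⟦ not (colour x) ∧ free x ⟧))

  sum-capacity : sum² capacity ≡ 2 * (#U * #U + #V * #V) + (#freeU + #freeV)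
  sum-capacity = begin
    sum² capacity
      ≡⟨ sum²-+ (λ x y → 2 * same x y) diagonal ⟩
    sum² (λ x y → 2 * same x y) + sum² diagonal
      ≡⟨ cong₂ _+_ same-pairs (sum²-diagonal (λ x → ⟦ free x ⟧)) ⟩
    2 * (#U * #U + #V * #V) + sum (λ x → ⟦ free x ⟧)
      ≡⟨ cong (2 * (#U * #U + #V * #V) +_) #free≡#freeU+#freeV ⟩
    2 * (#U * #U + #V * #V) + (#freeU + #freeV) ∎
    where
    open ≡-Reasoning
    same diagonal : Fin m → Fin m → ℕ
    same x y = ⟦ sameColour x y ⟧
    diagonal x y = ⟦ free x ⟧ * ⟦ x == y ⟧
    inU inV : Fin m → ℕ
    inU x = ⟦ colour x ⟧
    inV x = ⟦ not (colour x) ⟧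
    same-pairs : sum² (λ x y → 2 * same x y) ≡ 2 * (#U * #U + #V * #V)
    same-pairs = begin
      sum² (λ x y → 2 * same x y)
        ≡⟨ sum-cong-≗ (λ x → ≡.sym (*-distribˡ-sum 2 (same x))) ⟩
      sum (λ x → 2 * sum (same x))
        ≡⟨ ≡.sym (*-distribˡ-sum 2 (λ x → sum (same x))) ⟩
      2 * sum² same
        ≡⟨ cong (2 *_) (sum²-cong (λ x y → ⟦≟⟧ (colour x) (colour y))) ⟩
      2 * sum² (λ x y → inU x * inU y + inV x * inV y)
        ≡⟨ cong (2 *_) (sum²-+ (λ x y → inU x * inU y) (λ x y → inV x * inV y)) ⟩
      2 * (sum² (λ x y → inU x * inU y) + sum² (λ x y → inV x * inV y))
        ≡⟨ cong (2 *_) (cong₂ _+_ (sum²-* inU inU) (sum²-* inV inV)) ⟩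
      2 * (#U * #U + #V * #V) ∎

  module Balanced (#U≡#V : #U ≡ #V) (#freeU≡#freeV : #freeU ≡ #freeV) where

    private
      halve-load : 2 * adjacencySum G + (#freeU * #freeU + #freeV * #freeV) ≡ 2 * (adjacencySum G + #freeU * #freeU)
      halve-load = ≡.trans (cong (λ q → 2 * adjacencySum G + (#freeU * #freeU + q * q)) (≡.sym #freeU≡#freeV))
                           (identity (adjacencySum G) #freeU)
        where
        identity : ∀ a p → 2 * a + (p * p + p * p) ≡ 2 * (a + p * p)
        identity = solve-∀

      halve-capacity : 2 * (#U * #U + #V * #V) + (#freeU + #freeV) ≡ 2 * (2 * (#U * #U) + #freeU)
      halve-capacity = ≡.trans (cong₂ (λ v q → 2 * (#U * #U + v * v) + (#freeU + q)) (≡.sym #U≡#V) (≡.sym #freeU≡#freeV))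
                               (identity #U #freeU)
        where
        identity : ∀ u p → 2 * (u * u + u * u) + (p + p) ≡ 2 * (2 * (u * u) + p)
        identity = solve-∀

    adjacencySum-bound : (∀ x y → load x y ≤ capacity x y) → adjacencySum G + #freeU * #freeU ≤ 2 * (#U * #U) + #freeU
    adjacencySum-bound load≤cap =
      ℕP.*-cancelˡ-≤ 2 (subst₂ _≤_ (≡.trans sum-load halve-load) (≡.trans sum-capacity halve-capacity)
                                   (sum²-mono-≤ load≤cap))

    adjacencySum-exact : (∀ x y → load x y ≡ capacity x y) → adjacencySum G + #freeU * #freeU ≡ 2 * (#U * #U) + #freeU
    adjacencySum-exact load≡cap = ℕP.*-cancelˡ-≡ _ _ 2
      (≡.trans (≡.sym halve-load)
      (≡.trans (≡.sym sum-load) (≡.trans (sum²-cong load≡cap) (≡.trans sum-capacity halve-capacity))))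

    tight⇒load≡capacity : (∀ x y → load x y ≤ capacity x y) →
                          adjacencySum G + #freeU * #freeU ≡ 2 * (#U * #U) + #freeU → ∀ x y → load x y ≡ capacity x y
    tight⇒load≡capacity load≤cap tight = sum²-≤-antisym load≤cap (ℕP.≤-reflexive (begin
      sum² capacity                              ≡⟨ ≡.trans sum-capacity halve-capacity ⟩
      2 * (2 * (#U * #U) + #freeU)               ≡⟨ cong (2 *_) (≡.sym tight) ⟩
      2 * (adjacencySum G + #freeU * #freeU)     ≡⟨ ≡.sym (≡.trans sum-load halve-load) ⟩
      sum² load                                  ∎))
      where open ≡-Reasoning

diagonal-or-off : ∀ {m p} {P : Fin m → Fin m → Set p} → (∀ x → P x x) → (∀ {x y} → x ≢ y → P x y) → ∀ x y → P x y
diagonal-or-off diagonal off x y with x FinP.≟ y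
... | yes refl = diagonal x
... | no x≢y = off x≢y

transpose-ˡ : ∀ {m} (i j : Fin m) → Perm.transpose i j ⟨$⟩ʳ i ≡ j
transpose-ˡ i j with i FinP.≟ i
... | yes _ = refl
... | no i≢i = ⊥-elim (i≢i refl)

transpose-ʳ : ∀ {m} (i j : Fin m) → Perm.transpose i j ⟨$⟩ʳ j ≡ i
transpose-ʳ i j with j FinP.≟ i
... | yes refl = refl
... | no _ with j FinP.≟ j
...   | yes _ = refl
...   | no j≢j = ⊥-elim (j≢j refl)

transpose-other : ∀ {m} {i j k : Fin m} → k ≢ i → k ≢ j → Perm.transpose i j ⟨$⟩ʳ k ≡ k
transpose-other {i = i} {j} {k} k≢i k≢j with k FinP.≟ i
... | yes k≡i = ⊥-elim (k≢i k≡i)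
... | no _ with k FinP.≟ j
...   | yes k≡j = ⊥-elim (k≢j k≡j)
...   | no _ = refl

module _ {n : ℕ} where

  ↑ˡ≢↑ʳ : ∀ (i j : Fin n) → i ↑ˡ n ≢ n ↑ʳ j
  ↑ˡ≢↑ʳ i j i≡j with ≡.trans (≡.sym (FinP.splitAt-↑ˡ n i n)) (≡.trans (cong (splitAt n) i≡j) (FinP.splitAt-↑ʳ n n j))
  ... | ()

  ↑-view : ∀ (x : Fin (n + n)) → Σ (Fin n) (λ i → i ↑ˡ n ≡ x) ⊎ Σ (Fin n) (λ j → n ↑ʳ j ≡ x)
  ↑-view x with splitAt n x in e
  ... | inj₁ i = inj₁ (i , FinP.splitAt⁻¹-↑ˡ e)
  ... | inj₂ j = inj₂ (j , FinP.splitAt⁻¹-↑ʳ e)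

==-toℕ : ∀ {m} (i j : Fin m) → (i == j) ≡ (toℕ i ℕ.≡ᵇ toℕ j)
==-toℕ i j with i FinP.≟ j
... | yes refl = ≡.sym (dec-true (toℕ i ℕP.≟ toℕ i) refl)
... | no i≢j = ≡.sym (dec-false (toℕ i ℕP.≟ toℕ j) (i≢j ∘ FinP.toℕ-injective))

==-injective : ∀ {m m′} (f : Fin m → Fin m′) → (∀ {i j} → f i ≡ f j → i ≡ j) → ∀ i j → (f i == f j) ≡ (i == j)
==-injective f f-injective i j with i FinP.≟ j
... | yes refl = ==-refl (f i)
... | no i≢j = dec-false (f i FinP.≟ f j) (i≢j ∘ f-injective)

injective⇒surjective : ∀ {m} (f : Fin m → Fin m) → (∀ {x y} → f x ≡ f y → x ≡ y) → ∀ y → Σ (Fin m) (λ x → f x ≡ y)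
injective⇒surjective {suc m} f f-injective y with FinP.any? (λ x → f x FinP.≟ y)
... | yes found = found
... | no missed = ⊥-elim (ℕP.<-irrefl refl (FinP.injective⇒≤ {f = g} g-injective))
  where
  f≢y : ∀ x → y ≢ f x
  f≢y x y≡fx = missed (x , ≡.sym y≡fx)
  g : Fin (suc m) → Fin m
  g x = Fin.punchOut (f≢y x)
  g-injective : ∀ {a b} → g a ≡ g b → a ≡ b
  g-injective ga≡gb = f-injective (FinP.punchOut-injective (f≢y _) (f≢y _) ga≡gb)

injective⇒permutation : ∀ {m} (f : Fin m → Fin m) → (∀ {x y} → f x ≡ f y → x ≡ y) →
                        Σ (Permutation m m) (λ π → ∀ x → π ⟨$⟩ʳ x ≡ f x)
injective⇒permutation f f-injective =
  Perm.permutation f (proj₁ ∘ surjective) (proj₂ ∘ surjective) (λ x → f-injective (proj₂ (surjective (f x)))) , λ _ → refl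
  where surjective = injective⇒surjective f f-injective

-- The staircase graph H n k

staircase : ℕ → ℕ → ℕ → Bool
staircase L i j = not ((i <ᵇ j) ∧ (j <ᵇ L))

staircase-≤ : ∀ {L i j} → j ≤ i → staircase L i j ≡ true
staircase-≤ {L} {i} {j} j≤i = cong (λ b → not (b ∧ (j <ᵇ L))) (<ᵇ-false (ℕP.≤⇒≯ j≤i))

staircase-≥ : ∀ {L i j} → L ≤ j → staircase L i j ≡ true
staircase-≥ {L} {i} {j} L≤j =
  ≡.trans (cong (λ b → not ((i <ᵇ j) ∧ b)) (<ᵇ-false (ℕP.≤⇒≯ L≤j))) (cong not (BoolP.∧-zeroʳ (i <ᵇ j)))

staircase-< : ∀ {L i j} → i < j → j < L → staircase L i j ≡ false
staircase-< i<j j<L = cong₂ (λ a b → not (a ∧ b)) (<ᵇ-true i<j) (<ᵇ-true j<L)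

staircase-load : ∀ a b L → ⟦ staircase L a b ⟧ + ⟦ staircase L b a ⟧ + ⟦ (a <ᵇ L) ∧ (b <ᵇ L) ∧ true ⟧
                           ≡ 2 * 1 + ⟦ a <ᵇ L ⟧ * ⟦ a ℕ.≡ᵇ b ⟧
staircase-load zero zero zero = refl
staircase-load zero zero (suc L) = refl
staircase-load zero (suc b) zero = refl
staircase-load zero (suc b) (suc L) with b <ᵇ L
... | true = refl
... | false = refl
staircase-load (suc a) zero zero = refl
staircase-load (suc a) zero (suc L) with a <ᵇ L
... | true = refl
... | false = refl
staircase-load (suc a) (suc b) zero with a <ᵇ b | b <ᵇ a
... | true | true = refl
... | true | false = refl
... | false | true = refl
... | false | false = refl
staircase-load (suc a) (suc b) (suc L) = staircase-load a b L

count-<ᵇ : ∀ n L → L ≤ n → sum {n} (λ i → ⟦ toℕ i <ᵇ L ⟧) ≡ L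
count-<ᵇ n zero _ = ≡.trans (sum-cong-≗ {n} {λ i → ⟦ toℕ i <ᵇ 0 ⟧} (λ i → refl)) (sum-zero {n})
count-<ᵇ (suc n) (suc L) (s≤s L≤n) = cong suc (count-<ᵇ n L L≤n)

module _ (n k : ℕ) (i j : Fin n) where

  Hadj-uu : Hadj n k (i ↑ˡ n) (j ↑ˡ n) ≡ false
  Hadj-uu rewrite FinP.splitAt-↑ˡ n i n | FinP.splitAt-↑ˡ n j n = refl

  Hadj-vv : Hadj n k (n ↑ʳ i) (n ↑ʳ j) ≡ false
  Hadj-vv rewrite FinP.splitAt-↑ʳ n n i | FinP.splitAt-↑ʳ n n j = refl

  Hadj-uv : Hadj n k (i ↑ˡ n) (n ↑ʳ j) ≡ staircase (n ∸ k) (toℕ i) (toℕ j)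
  Hadj-uv rewrite FinP.splitAt-↑ˡ n i n | FinP.splitAt-↑ʳ n n j = refl

  Hadj-vu : Hadj n k (n ↑ʳ j) (i ↑ˡ n) ≡ staircase (n ∸ k) (toℕ i) (toℕ j)
  Hadj-vu rewrite FinP.splitAt-↑ˡ n i n | FinP.splitAt-↑ʳ n n j = refl

module Recognition (n k : ℕ) (G : Graph (n + n)) (colour : Fin (n + n) → Bool)
  (proper : ∀ x y → adj G x y ≡ true → colour x ≢ colour y)
  (M : PerfectMatching G) (colour-μ : ∀ x → colour (mate M x) ≡ not (colour x))
  (index : Fin (n + n) → ℕ)
  (index<n : ∀ {x} → colour x ≡ true → index x < n)
  (index-injective : ∀ {x y} → colour x ≡ true → colour y ≡ true → index x ≡ index y → x ≡ y)
  (arc-index : ∀ {x y} → colour x ≡ true → colour y ≡ true →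
               adj G x (mate M y) ≡ staircase (n ∸ k) (index x) (index y)) where

  μ : Fin (n + n) → Fin (n + n)
  μ = mate M

  ι : ∀ {x} → colour x ≡ true → Fin n
  ι x∈U = Fin.fromℕ< (index<n x∈U)

  toℕ-ι : ∀ {x} (x∈U : colour x ≡ true) → toℕ (ι x∈U) ≡ index x
  toℕ-ι x∈U = FinP.toℕ-fromℕ< (index<n x∈U)

  μ∈U : ∀ {x} → colour x ≡ false → colour (μ x) ≡ true
  μ∈U {x} x∈V = ≡.trans (colour-μ x) (cong not x∈V)

  φ-by : ∀ x b → colour x ≡ b → Fin (n + n)
  φ-by x true x∈U = ι x∈U ↑ˡ n
  φ-by x false x∈V = n ↑ʳ ι (μ∈U x∈V)

  φ : Fin (n + n) → Fin (n + n)
  φ x = φ-by x (colour x) refl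

  φᵁ : ∀ {x} (x∈U : colour x ≡ true) → φ x ≡ ι x∈U ↑ˡ n
  φᵁ {x} x∈U = by (colour x) refl
    where
    by : ∀ b (e : colour x ≡ b) → φ-by x b e ≡ ι x∈U ↑ˡ n
    by true e = refl
    by false e = ⊥-elim (BoolP.not-¬ e x∈U)

  φⱽ : ∀ {x} (x∈V : colour x ≡ false) → φ x ≡ n ↑ʳ ι (μ∈U x∈V)
  φⱽ {x} x∈V = by (colour x) refl
    where
    by : ∀ b (e : colour x ≡ b) → φ-by x b e ≡ n ↑ʳ ι (μ∈U x∈V)
    by true e = ⊥-elim (BoolP.not-¬ e x∈V)
    by false e = refl

  toℕ-φᵁ : ∀ {x} (x∈U : colour x ≡ true) {i} → φ x ≡ i ↑ˡ n → index x ≡ toℕ i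
  toℕ-φᵁ x∈U φx≡i = ≡.trans (≡.sym (toℕ-ι x∈U)) (cong toℕ (FinP.↑ˡ-injective n _ _ (≡.trans (≡.sym (φᵁ x∈U)) φx≡i)))

  toℕ-φⱽ : ∀ {x} (x∈V : colour x ≡ false) {j} → φ x ≡ n ↑ʳ j → index (μ x) ≡ toℕ j
  toℕ-φⱽ x∈V φx≡j = ≡.trans (≡.sym (toℕ-ι (μ∈U x∈V))) (cong toℕ (FinP.↑ʳ-injective n _ _ (≡.trans (≡.sym (φⱽ x∈V)) φx≡j)))

  φ-injective : ∀ {x y} → φ x ≡ φ y → x ≡ y
  φ-injective {x} {y} φx≡φy = by-cases (colour x)
    (λ x∈U → by-cases (colour y)
      (λ y∈U → index-injective x∈U y∈U (≡.trans (toℕ-φᵁ x∈U (≡.trans φx≡φy (φᵁ y∈U))) (toℕ-ι y∈U)))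
      (λ y∈V → ⊥-elim (↑ˡ≢↑ʳ _ _ (≡.trans (≡.sym (φᵁ x∈U)) (≡.trans φx≡φy (φⱽ y∈V))))))
    (λ x∈V → by-cases (colour y)
      (λ y∈U → ⊥-elim (↑ˡ≢↑ʳ _ _ (≡.trans (≡.sym (φᵁ y∈U)) (≡.trans (≡.sym φx≡φy) (φⱽ x∈V)))))
      (λ y∈V → μ-injective (index-injective (μ∈U x∈V) (μ∈U y∈V)
                 (≡.trans (toℕ-φⱽ x∈V (≡.trans φx≡φy (φⱽ y∈V))) (toℕ-ι (μ∈U y∈V))))))
    where
    μ-injective : ∀ {x y} → μ x ≡ μ y → x ≡ y
    μ-injective {x} {y} μx≡μy = ≡.trans (≡.sym (invol M x)) (≡.trans (cong μ μx≡μy) (invol M y))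

  non-adjacent : ∀ {x y} → colour x ≡ colour y → adj G x y ≡ false
  non-adjacent {x} {y} cx≡cy = BoolP.¬-not (λ x~y → proper x y x~y cx≡cy)

  φ-adjᵁⱽ : ∀ {x y} → colour x ≡ true → colour y ≡ false → adj G x y ≡ Hadj n k (φ x) (φ y)
  φ-adjᵁⱽ {x} {y} x∈U y∈V = begin
    adj G x y                                      ≡⟨ cong (adj G x) (≡.sym (invol M y)) ⟩
    adj G x (μ (μ y))                              ≡⟨ arc-index x∈U (μ∈U y∈V) ⟩
    staircase (n ∸ k) (index x) (index (μ y))
      ≡⟨ cong₂ (staircase (n ∸ k)) (≡.sym (toℕ-ι x∈U)) (≡.sym (toℕ-ι (μ∈U y∈V))) ⟩
    staircase (n ∸ k) (toℕ (ι x∈U)) (toℕ (ι (μ∈U y∈V)))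
      ≡⟨ ≡.sym (Hadj-uv n k _ _) ⟩
    Hadj n k (ι x∈U ↑ˡ n) (n ↑ʳ ι (μ∈U y∈V))       ≡⟨ ≡.sym (cong₂ (Hadj n k) (φᵁ x∈U) (φⱽ y∈V)) ⟩
    Hadj n k (φ x) (φ y)                           ∎
    where open ≡-Reasoning

  φ-adj : ∀ x y → adj G x y ≡ Hadj n k (φ x) (φ y)
  φ-adj x y = by-cases (colour x)
    (λ x∈U → by-cases (colour y)
      (λ y∈U → ≡.trans (non-adjacent (≡.trans x∈U (≡.sym y∈U)))
                       (≡.sym (≡.trans (cong₂ (Hadj n k) (φᵁ x∈U) (φᵁ y∈U)) (Hadj-uu n k _ _))))
      (φ-adjᵁⱽ x∈U))
    (λ x∈V → by-cases (colour y)
      (λ y∈U → ≡.trans (Graph.sym G x y) (≡.trans (φ-adjᵁⱽ y∈U x∈V) (Graph.sym (H n k) (φ y) (φ x))))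
      (λ y∈V → ≡.trans (non-adjacent (≡.trans x∈V (≡.sym y∈V)))
                       (≡.sym (≡.trans (cong₂ (Hadj n k) (φⱽ x∈V) (φⱽ y∈V)) (Hadj-vv n k _ _)))))

  ≅H : Isomorphic G (H n k)
  ≅H = let π , π≗φ = injective⇒permutation φ φ-injective in
       π , λ x y → ≡.trans (φ-adj x y) (≡.sym (cong₂ (Hadj n k) (π≗φ x) (π≗φ y)))

bound+square : ∀ n k → k ≤ n → (n ∸ k) * (n + k + 1) + 2 * (n * k) + (n ∸ k) * (n ∸ k) ≡ 2 * (n * n) + (n ∸ k)
bound+square n k k≤n with n ∸ k | ℕP.m∸n+n≡m k≤n
... | p | refl = identity p k
  where
  identity : ∀ p k → p * (p + k + k + 1) + 2 * ((p + k) * k) + p * p ≡ 2 * ((p + k) * (p + k)) + p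
  identity = solve-∀

module HCount (n k : ℕ) (k≤n : k ≤ n) where

  L : ℕ
  L = n ∸ k

  side : Fin (n + n) → Bool
  side x = [ (λ _ → true) , (λ _ → false) ]′ (splitAt n x)

  swap : Fin (n + n) → Fin (n + n)
  swap x = [ n ↑ʳ_ , _↑ˡ n ]′ (splitAt n x)

  low : Fin (n + n) → Bool
  low x = [ toℕ , toℕ ]′ (splitAt n x) <ᵇ L

  module _ (i : Fin n) where
    sideᵁ : side (i ↑ˡ n) ≡ true
    sideᵁ = cong [ (λ _ → true) , (λ _ → false) ]′ (FinP.splitAt-↑ˡ n i n)
    sideⱽ : side (n ↑ʳ i) ≡ false
    sideⱽ = cong [ (λ _ → true) , (λ _ → false) ]′ (FinP.splitAt-↑ʳ n n i)
    swapᵁ : swap (i ↑ˡ n) ≡ n ↑ʳ i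
    swapᵁ = cong [ n ↑ʳ_ , _↑ˡ n ]′ (FinP.splitAt-↑ˡ n i n)
    swapⱽ : swap (n ↑ʳ i) ≡ i ↑ˡ n
    swapⱽ = cong [ n ↑ʳ_ , _↑ˡ n ]′ (FinP.splitAt-↑ʳ n n i)
    lowᵁ : low (i ↑ˡ n) ≡ (toℕ i <ᵇ L)
    lowᵁ = cong (λ s → [ toℕ , toℕ ]′ s <ᵇ L) (FinP.splitAt-↑ˡ n i n)
    lowⱽ : low (n ↑ʳ i) ≡ (toℕ i <ᵇ L)
    lowⱽ = cong (λ s → [ toℕ , toℕ ]′ s <ᵇ L) (FinP.splitAt-↑ʳ n n i)

  swap-involutive : ∀ x → swap (swap x) ≡ x
  swap-involutive x with ↑-view {n} x
  ... | inj₁ (i , refl) = ≡.trans (cong swap (swapᵁ i)) (swapⱽ i)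
  ... | inj₂ (j , refl) = ≡.trans (cong swap (swapⱽ j)) (swapᵁ j)

  swapPermutation : Permutation (n + n) (n + n)
  swapPermutation = Perm.permutation swap swap swap-involutive swap-involutive

  open PairCount (H n k) swapPermutation side low

  arcᵁᵁ : ∀ i j → arc (i ↑ˡ n) (j ↑ˡ n) ≡ staircase L (toℕ i) (toℕ j)
  arcᵁᵁ i j = ≡.trans (cong (Hadj n k (i ↑ˡ n)) (swapᵁ j)) (Hadj-uv n k i j)

  arcⱽⱽ : ∀ i j → arc (n ↑ʳ i) (n ↑ʳ j) ≡ staircase L (toℕ j) (toℕ i)
  arcⱽⱽ i j = ≡.trans (cong (Hadj n k (n ↑ʳ i)) (swapⱽ j)) (Hadj-vu n k j i)

  arcᵁⱽ : ∀ i j → arc (i ↑ˡ n) (n ↑ʳ j) ≡ false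
  arcᵁⱽ i j = ≡.trans (cong (Hadj n k (i ↑ˡ n)) (swapⱽ j)) (Hadj-uu n k i j)

  arcⱽᵁ : ∀ i j → arc (n ↑ʳ i) (j ↑ˡ n) ≡ false
  arcⱽᵁ i j = ≡.trans (cong (Hadj n k (n ↑ʳ i)) (swapᵁ j)) (Hadj-vv n k i j)

  sameColour-sides : ∀ {x y s t} → side x ≡ s → side y ≡ t → sameColour x y ≡ does (s Bool.≟ t)
  sameColour-sides = cong₂ (λ s t → does (s Bool.≟ t))

  same-side : ∀ {x y a b} → ⟦ arc x y ⟧ + ⟦ arc y x ⟧ ≡ ⟦ staircase L a b ⟧ + ⟦ staircase L b a ⟧ →
              low x ≡ (a <ᵇ L) → low y ≡ (b <ᵇ L) → sameColour x y ≡ true → (x == y) ≡ (a ℕ.≡ᵇ b) →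
              load x y ≡ capacity x y
  same-side {x} {y} {a} {b} arcs low-x low-y same x==y = begin
    load x y
      ≡⟨ cong₂ _+_ arcs (cong ⟦_⟧ (cong₂ _∧_ low-x (cong₂ _∧_ low-y same))) ⟩
    ⟦ staircase L a b ⟧ + ⟦ staircase L b a ⟧ + ⟦ (a <ᵇ L) ∧ (b <ᵇ L) ∧ true ⟧
      ≡⟨ staircase-load a b L ⟩
    2 * 1 + ⟦ a <ᵇ L ⟧ * ⟦ a ℕ.≡ᵇ b ⟧
      ≡⟨ ≡.sym (cong (λ l → 2 * 1 + ⟦ l ⟧ * ⟦ a ℕ.≡ᵇ b ⟧) low-x) ⟩
    2 * 1 + ⟦ low x ⟧ * ⟦ a ℕ.≡ᵇ b ⟧
      ≡⟨ ≡.sym (cong₂ (λ s e → 2 * ⟦ s ⟧ + ⟦ low x ⟧ * ⟦ e ⟧) same x==y) ⟩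
    capacity x y
      ∎
    where open ≡-Reasoning

  across : ∀ {x y} → x ≢ y → arc x y ≡ false → arc y x ≡ false → sameColour x y ≡ false → load x y ≡ capacity x y
  across {x} {y} x≢y x↛y y↛x different = begin
    load x y                   ≡⟨ cong₂ _+_ (cong₂ _+_ (cong ⟦_⟧ x↛y) (cong ⟦_⟧ y↛x))
                                            (cong (λ s → ⟦ low x ∧ low y ∧ s ⟧) different) ⟩
    ⟦ low x ∧ low y ∧ false ⟧  ≡⟨ cong (λ b → ⟦ low x ∧ b ⟧) (BoolP.∧-zeroʳ (low y)) ⟩
    ⟦ low x ∧ false ⟧          ≡⟨ cong ⟦_⟧ (BoolP.∧-zeroʳ (low x)) ⟩
    0                          ≡⟨ cong (λ s → 2 * ⟦ s ⟧) (≡.sym different) ⟩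
    2 * ⟦ sameColour x y ⟧     ≡⟨ ≡.sym (capacity-≢ x≢y) ⟩
    capacity x y               ∎
    where open ≡-Reasoning

  load≡capacity : ∀ x y → load x y ≡ capacity x y
  load≡capacity x y with ↑-view {n} x | ↑-view {n} y
  ... | inj₁ (i , refl) | inj₁ (j , refl) =
    same-side (cong₂ _+_ (cong ⟦_⟧ (arcᵁᵁ i j)) (cong ⟦_⟧ (arcᵁᵁ j i))) (lowᵁ i) (lowᵁ j)
              (sameColour-sides (sideᵁ i) (sideᵁ j))
              (≡.trans (==-injective (_↑ˡ n) (FinP.↑ˡ-injective n _ _) i j) (==-toℕ i j))
  ... | inj₂ (i , refl) | inj₂ (j , refl) =
    same-side (≡.trans (cong₂ _+_ (cong ⟦_⟧ (arcⱽⱽ i j)) (cong ⟦_⟧ (arcⱽⱽ j i)))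
                       (ℕP.+-comm ⟦ staircase L (toℕ j) (toℕ i) ⟧ _))
              (lowⱽ i) (lowⱽ j)
              (sameColour-sides (sideⱽ i) (sideⱽ j))
              (≡.trans (==-injective (n ↑ʳ_) (FinP.↑ʳ-injective n _ _) i j) (==-toℕ i j))
  ... | inj₁ (i , refl) | inj₂ (j , refl) =
    across (↑ˡ≢↑ʳ i j) (arcᵁⱽ i j) (arcⱽᵁ j i) (sameColour-sides (sideᵁ i) (sideⱽ j))
  ... | inj₂ (i , refl) | inj₁ (j , refl) =
    across (≡.≢-sym (↑ˡ≢↑ʳ j i)) (arcⱽᵁ i j) (arcᵁⱽ j i) (sameColour-sides (sideⱽ i) (sideᵁ j))

  private
    sum-sides : ∀ (f : Fin (n + n) → ℕ) {a b} → (∀ i → f (i ↑ˡ n) ≡ a i) → (∀ j → f (n ↑ʳ j) ≡ b j) →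
                sum f ≡ sum a + sum b
    sum-sides f fᵁ fⱽ = ≡.trans (sum-↑ n f) (cong₂ _+_ (sum-cong-≗ fᵁ) (sum-cong-≗ fⱽ))

  #U≡n : #U ≡ n
  #U≡n = ≡.trans (sum-sides (λ x → ⟦ side x ⟧) (cong ⟦_⟧ ∘ sideᵁ) (cong ⟦_⟧ ∘ sideⱽ))
                 (≡.trans (cong₂ _+_ (sum-one {n}) (sum-zero {n})) (ℕP.+-identityʳ n))

  #V≡n : #V ≡ n
  #V≡n = ≡.trans (sum-sides (λ x → ⟦ not (side x) ⟧) (cong (⟦_⟧ ∘ not) ∘ sideᵁ) (cong (⟦_⟧ ∘ not) ∘ sideⱽ))
                 (cong₂ _+_ (sum-zero {n}) (sum-one {n}))

  #freeU≡L : #freeU ≡ L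
  #freeU≡L = ≡.trans (sum-sides (λ x → ⟦ side x ∧ low x ⟧)
                                (λ i → cong₂ (λ s l → ⟦ s ∧ l ⟧) (sideᵁ i) (lowᵁ i))
                                (λ j → cong (λ s → ⟦ s ∧ low (n ↑ʳ j) ⟧) (sideⱽ j)))
                     (≡.trans (cong₂ _+_ (count-<ᵇ n L (ℕP.m∸n≤m n k)) (sum-zero {n})) (ℕP.+-identityʳ L))

  #freeV≡L : #freeV ≡ L
  #freeV≡L = ≡.trans (sum-sides (λ x → ⟦ not (side x) ∧ low x ⟧)
                                (λ i → cong (λ s → ⟦ not s ∧ low (i ↑ˡ n) ⟧) (sideᵁ i))
                                (λ j → cong₂ (λ s l → ⟦ not s ∧ l ⟧) (sideⱽ j) (lowⱽ j)))
                     (cong₂ _+_ (sum-zero {n}) (count-<ᵇ n L (ℕP.m∸n≤m n k)))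

  adjacencySum+L² : adjacencySum (H n k) + L * L ≡ 2 * (n * n) + L
  adjacencySum+L² = subst₂ (λ p u → adjacencySum (H n k) + p * p ≡ 2 * (u * u) + p) #freeU≡L #U≡n
    (Balanced.adjacencySum-exact (≡.trans #U≡n (≡.sym #V≡n)) (≡.trans #freeU≡L (≡.sym #freeV≡L)) load≡capacity)

  adjacencySum-H : adjacencySum (H n k) ≡ (n ∸ k) * (n + k + 1) + 2 * (n * k)
  adjacencySum-H = ℕP.+-cancelʳ-≡ (L * L) _ _ (≡.trans adjacencySum+L² (≡.sym (bound+square n k k≤n)))

-- Forcing sets in bipartite graphs

module Forcing {m : ℕ} (G : Graph m) (colour : Fin m → Bool)
  (proper : ∀ x y → adj G x y ≡ true → colour x ≢ colour y)
  (M : PerfectMatching G) (S : EdgeSubset M) (forcing : IsForcingSet M S) where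

  μ : Fin m → Fin m
  μ = mate M

  free : Fin m → Bool
  free x = not (mem S x)

  matePermutation : Permutation m m
  matePermutation = Perm.permutation μ μ (invol M) (invol M)

  open PairCount G matePermutation colour free public

  colour-μ : ∀ x → colour (μ x) ≡ not (colour x)
  colour-μ x = BoolP.¬-not (≡.≢-sym (proper x (μ x) (isEdge M x)))

  free-μ : ∀ x → free (μ x) ≡ free x
  free-μ x = cong not (≡.sym (closed S x))

  μ-injective : ∀ {x y} → μ x ≡ μ y → x ≡ y
  μ-injective {x} {y} μx≡μy = ≡.trans (≡.sym (invol M x)) (≡.trans (cong μ μx≡μy) (invol M y))

  arc-refl : ∀ x → arc x x ≡ true
  arc-refl = isEdge M

  arc-μ : ∀ x y → arc (μ y) (μ x) ≡ arc x y
  arc-μ x y = ≡.trans (cong (adj G (μ y)) (invol M x)) (Graph.sym G (μ y) x)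

  arc-sameColour : ∀ {x y} → arc x y ≡ true → colour x ≡ colour y
  arc-sameColour {x} {y} x→y = begin
    colour x              ≡⟨ BoolP.¬-not (proper x (μ y) x→y) ⟩
    not (colour (μ y))    ≡⟨ cong not (colour-μ y) ⟩
    not (not (colour y))  ≡⟨ BoolP.not-involutive (colour y) ⟩
    colour y              ∎
    where open ≡-Reasoning

  -- The perfect matching {w, μ (σ w)} (w ∈ U) built here contains S, so it must be M itself.
  module Rematching (σ : Permutation m m)
    (σ-colour : ∀ w → colour (σ ⟨$⟩ʳ w) ≡ colour w)
    (σ-fixes-S : ∀ w → mem S w ≡ true → σ ⟨$⟩ʳ w ≡ w)
    (σ-arc : ∀ w → colour w ≡ true → arc w (σ ⟨$⟩ʳ w) ≡ true) where

    rematch : Fin m → Fin m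
    rematch z = if colour z then μ (σ ⟨$⟩ʳ z) else σ ⟨$⟩ˡ μ z

    rematchᵁ : ∀ {z} → colour z ≡ true → rematch z ≡ μ (σ ⟨$⟩ʳ z)
    rematchᵁ e rewrite e = refl

    rematchⱽ : ∀ {z} → colour z ≡ false → rematch z ≡ σ ⟨$⟩ˡ μ z
    rematchⱽ e rewrite e = refl

    colour-σ⁻¹ : ∀ w → colour (σ ⟨$⟩ˡ w) ≡ colour w
    colour-σ⁻¹ w = ≡.trans (≡.sym (σ-colour (σ ⟨$⟩ˡ w))) (cong colour (Perm.inverseʳ σ))

    colour-rematch : ∀ z → colour (rematch z) ≡ not (colour z)
    colour-rematch z with colour z in e
    ... | true = ≡.trans (colour-μ _) (cong not (≡.trans (σ-colour z) e))
    ... | false = ≡.trans (colour-σ⁻¹ _) (≡.trans (colour-μ z) (cong not e))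

    rematch-involutive : ∀ z → rematch (rematch z) ≡ z
    rematch-involutive z with colour z in e
    ... | true = begin
      rematch (μ (σ ⟨$⟩ʳ z))     ≡⟨ rematchⱽ (≡.trans (colour-μ _) (cong not (≡.trans (σ-colour z) e))) ⟩
      σ ⟨$⟩ˡ μ (μ (σ ⟨$⟩ʳ z))     ≡⟨ cong (σ ⟨$⟩ˡ_) (invol M _) ⟩
      σ ⟨$⟩ˡ (σ ⟨$⟩ʳ z)           ≡⟨ Perm.inverseˡ σ ⟩
      z                          ∎
      where open ≡-Reasoning
    ... | false = begin
      rematch (σ ⟨$⟩ˡ μ z)        ≡⟨ rematchᵁ (≡.trans (colour-σ⁻¹ _) (≡.trans (colour-μ z) (cong not e))) ⟩
      μ (σ ⟨$⟩ʳ (σ ⟨$⟩ˡ μ z))     ≡⟨ cong μ (Perm.inverseʳ σ) ⟩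
      μ (μ z)                    ≡⟨ invol M z ⟩
      z                          ∎
      where open ≡-Reasoning

    rematch-edge : ∀ z → adj G z (rematch z) ≡ true
    rematch-edge z with colour z in e
    ... | true = σ-arc z e
    ... | false = begin
      adj G z (σ ⟨$⟩ˡ μ z)            ≡⟨ Graph.sym G z w ⟩
      adj G w z                       ≡⟨ cong (adj G w) (≡.sym μσw≡z) ⟩
      adj G w (μ (σ ⟨$⟩ʳ w))          ≡⟨ σ-arc w (≡.trans (colour-σ⁻¹ _) (≡.trans (colour-μ z) (cong not e))) ⟩
      true                            ∎
      where
      open ≡-Reasoning
      w = σ ⟨$⟩ˡ μ z
      μσw≡z : μ (σ ⟨$⟩ʳ w) ≡ z
      μσw≡z = ≡.trans (cong μ (Perm.inverseʳ σ)) (invol M z)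

    rematching : PerfectMatching G
    rematching = record
      { mate = rematch
      ; invol = rematch-involutive
      ; noFix = λ z rz≡z → BoolP.not-¬ refl (≡.trans (cong colour (≡.sym rz≡z)) (colour-rematch z))
      ; isEdge = rematch-edge
      }

    S⊆rematching : ContainedIn S rematching
    S⊆rematching z z∈S with colour z in e
    ... | true = cong μ (σ-fixes-S z z∈S)
    ... | false = ≡.trans (cong (σ ⟨$⟩ˡ_) (≡.sym (σ-fixes-S (μ z) μz∈S))) (Perm.inverseˡ σ)
      where μz∈S = ≡.trans (≡.sym (closed S z)) z∈S

    σ-fixes-U : ∀ w → colour w ≡ true → σ ⟨$⟩ʳ w ≡ w
    σ-fixes-U w e = μ-injective (≡.trans (≡.sym (rematchᵁ e)) (forcing rematching S⊆rematching w))

  freeᵁ : Fin m → Bool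
  freeᵁ x = colour x ∧ free x

  FreeArc : Permutation m m → Fin m → Set
  FreeArc σ w = σ ⟨$⟩ʳ w ≢ w → freeᵁ w ≡ true × arc w (σ ⟨$⟩ʳ w) ≡ true

  FreeCycle : Permutation m m → Set
  FreeCycle σ = ∀ w → FreeArc σ w

  free-cycle-trivial : ∀ σ → FreeCycle σ → ∀ w → σ ⟨$⟩ʳ w ≡ w
  free-cycle-trivial σ cycle w =
    fixed-or w (λ moved → ⊥-elim (moved (Rematching.σ-fixes-U σ σ-colour σ-fixes-S σ-arc w (inU moved)))) id
    where
    fixed-or : ∀ {p} {P : Set p} w → (σ ⟨$⟩ʳ w ≢ w → P) → (σ ⟨$⟩ʳ w ≡ w → P) → P
    fixed-or w moved fixed with σ ⟨$⟩ʳ w FinP.≟ w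
    ... | yes σw≡w = fixed σw≡w
    ... | no σw≢w = moved σw≢w
    σ-injective : ∀ {v w} → σ ⟨$⟩ʳ v ≡ σ ⟨$⟩ʳ w → v ≡ w
    σ-injective {v} {w} e = ≡.trans (≡.sym (Perm.inverseˡ σ)) (≡.trans (cong (σ ⟨$⟩ˡ_) e) (Perm.inverseˡ σ))
    inU : ∀ {w} → σ ⟨$⟩ʳ w ≢ w → colour w ≡ true
    inU moved = BoolP.∧-conicalˡ _ _ (proj₁ (cycle _ moved))
    σ-colour : ∀ w → colour (σ ⟨$⟩ʳ w) ≡ colour w
    σ-colour w = fixed-or w
      (λ moved → ≡.trans (inU (λ σσw≡σw → moved (σ-injective σσw≡σw))) (≡.sym (inU moved)))
      (cong colour)
    σ-fixes-S : ∀ w → mem S w ≡ true → σ ⟨$⟩ʳ w ≡ w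
    σ-fixes-S w w∈S = fixed-or w
      (λ moved → ⊥-elim (BoolP.not-¬ w∈S (BoolP.not-injective (BoolP.∧-conicalʳ _ _ (proj₁ (cycle w moved))))))
      id
    σ-arc : ∀ w → colour w ≡ true → arc w (σ ⟨$⟩ʳ w) ≡ true
    σ-arc w _ = fixed-or w (proj₂ ∘ cycle w) (λ σw≡w → ≡.trans (cong (arc w) σw≡w) (arc-refl w))

  by-≟ : ∀ σ w x → FreeArc σ x → (w ≢ x → FreeArc σ w) → FreeArc σ w
  by-≟ σ w x at-x elsewhere with w FinP.≟ x
  ... | yes refl = at-x
  ... | no w≢x = elsewhere w≢x

  no-2-cycleᵁ : ∀ {x y} → freeᵁ x ≡ true → freeᵁ y ≡ true → x ≢ y → arc x y ≡ true → arc y x ≡ true → ⊥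
  no-2-cycleᵁ {x} {y} x∈freeᵁ y∈freeᵁ x≢y x→y y→x =
    x≢y (≡.trans (≡.sym (free-cycle-trivial σ cycle x)) (transpose-ˡ x y))
    where
    σ = Perm.transpose x y
    cycle : FreeCycle σ
    cycle w = by-≟ σ w x (λ _ → x∈freeᵁ , ≡.trans (cong (arc x) (transpose-ˡ x y)) x→y) λ w≢x →
              by-≟ σ w y (λ _ → y∈freeᵁ , ≡.trans (cong (arc y) (transpose-ʳ x y)) y→x) λ w≢y moved →
              ⊥-elim (moved (transpose-other w≢x w≢y))

  no-2-cycle : ∀ {x y} → colour x ≡ colour y → free x ≡ true → free y ≡ true → x ≢ y →
               arc x y ≡ true → arc y x ≡ true → ⊥
  no-2-cycle {x} {y} cx≡cy fx fy x≢y x→y y→x with colour x in e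
  ... | true = no-2-cycleᵁ (∧-intro e fx) (∧-intro (≡.sym cx≡cy) fy) x≢y x→y y→x
  ... | false = no-2-cycleᵁ
    (∧-intro (≡.trans (colour-μ y) (cong not (≡.sym cx≡cy))) (≡.trans (free-μ y) fy))
    (∧-intro (≡.trans (colour-μ x) (cong not e)) (≡.trans (free-μ x) fx))
    (λ μy≡μx → x≢y (≡.sym (μ-injective μy≡μx)))
    (≡.trans (arc-μ x y) x→y) (≡.trans (arc-μ y x) y→x)

  no-3-cycleᵁ : ∀ {x y z} → freeᵁ x ≡ true → freeᵁ y ≡ true → freeᵁ z ≡ true → x ≢ y → y ≢ z → z ≢ x →
                arc x y ≡ true → arc y z ≡ true → arc z x ≡ true → ⊥
  no-3-cycleᵁ {x} {y} {z} x∈freeᵁ y∈freeᵁ z∈freeᵁ x≢y y≢z z≢x x→y y→z z→x =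
    x≢y (≡.trans (≡.sym (free-cycle-trivial σ cycle x)) σx≡y)
    where
    σ = Perm.transpose x y Perm.∘ₚ Perm.transpose x z
    σx≡y : σ ⟨$⟩ʳ x ≡ y
    σx≡y = ≡.trans (cong (Perm.transpose x z ⟨$⟩ʳ_) (transpose-ˡ x y)) (transpose-other (≡.≢-sym x≢y) y≢z)
    σy≡z : σ ⟨$⟩ʳ y ≡ z
    σy≡z = ≡.trans (cong (Perm.transpose x z ⟨$⟩ʳ_) (transpose-ʳ x y)) (transpose-ˡ x z)
    σz≡x : σ ⟨$⟩ʳ z ≡ x
    σz≡x = ≡.trans (cong (Perm.transpose x z ⟨$⟩ʳ_) (transpose-other z≢x (≡.≢-sym y≢z))) (transpose-ʳ x z)
    cycle : FreeCycle σ
    cycle w = by-≟ σ w x (λ _ → x∈freeᵁ , ≡.trans (cong (arc x) σx≡y) x→y) λ w≢x →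
              by-≟ σ w y (λ _ → y∈freeᵁ , ≡.trans (cong (arc y) σy≡z) y→z) λ w≢y →
              by-≟ σ w z (λ _ → z∈freeᵁ , ≡.trans (cong (arc z) σz≡x) z→x) λ w≢z moved →
              ⊥-elim (moved (≡.trans (cong (Perm.transpose x z ⟨$⟩ʳ_) (transpose-other w≢x w≢y))
                                     (transpose-other w≢x w≢z)))

  load-diagonal : ∀ x → load x x ≡ capacity x x
  load-diagonal x = begin
    ⟦ arc x x ⟧ + ⟦ arc x x ⟧ + ⟦ free x ∧ free x ∧ sameColour x x ⟧
      ≡⟨ cong₂ (λ a s → ⟦ a ⟧ + ⟦ a ⟧ + ⟦ free x ∧ free x ∧ s ⟧) (arc-refl x) (sameColour-≡ refl) ⟩
    2 + ⟦ free x ∧ free x ∧ true ⟧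
      ≡⟨ diagonal-count (free x) ⟩
    2 * 1 + ⟦ free x ⟧ * 1
      ≡⟨ ≡.sym (cong₂ (λ s e → 2 * ⟦ s ⟧ + ⟦ free x ⟧ * ⟦ e ⟧) (sameColour-≡ refl) (==-refl x)) ⟩
    capacity x x ∎
    where
    open ≡-Reasoning
    diagonal-count : ∀ f → 2 + ⟦ f ∧ f ∧ true ⟧ ≡ 2 * 1 + ⟦ f ⟧ * 1
    diagonal-count true = refl
    diagonal-count false = refl

  load≤capacity : ∀ x y → load x y ≤ capacity x y
  load≤capacity = diagonal-or-off (ℕP.≤-reflexive ∘ load-diagonal) off-diagonal
    where
    off-diagonal : ∀ {x y} → x ≢ y → load x y ≤ capacity x y
    off-diagonal {x} {y} x≢y = subst (load x y ≤_) (≡.sym (capacity-≢ x≢y)) (at-most-two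
      (λ x→y → sameColour-≡ (arc-sameColour x→y))
      (λ y→x → sameColour-≡ (≡.sym (arc-sameColour y→x)))
      (λ both → proj₂ (proj₂ (both-free both)))
      (λ x→y y→x both → let fx , fy , _ = both-free both in no-2-cycle (arc-sameColour x→y) fx fy x≢y x→y y→x))
      where
      both-free : (free x ∧ free y ∧ sameColour x y) ≡ true → free x ≡ true × free y ≡ true × sameColour x y ≡ true
      both-free both = let fx , rest = ∧-elim (free x) both in fx , ∧-elim (free y) rest

  #U≡#V : #U ≡ #V
  #U≡#V = ≡.trans (sum-permute (λ x → ⟦ colour x ⟧) matePermutation) (sum-cong-≗ (λ x → cong ⟦_⟧ (colour-μ x)))

  #freeU≡#freeV : #freeU ≡ #freeV
  #freeU≡#freeV = ≡.trans (sum-permute (λ x → ⟦ colour x ∧ free x ⟧) matePermutation)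
                          (sum-cong-≗ (λ x → cong₂ (λ c f → ⟦ c ∧ f ⟧) (colour-μ x) (free-μ x)))

  #U+#V≡m : #U + #V ≡ m
  #U+#V≡m = ≡.trans (≡.sym (∑-distrib-+ (λ x → ⟦ colour x ⟧) (λ x → ⟦ not (colour x) ⟧)))
                    (≡.trans (sum-cong-≗ (⟦⟧-+-not ∘ colour)) sum-one)

  2*#U≡m : 2 * #U ≡ m
  2*#U≡m = ≡.trans (cong (#U +_) (≡.trans (ℕP.+-identityʳ #U) #U≡#V)) #U+#V≡m

  #S≡2*subsetSize : sum (λ x → ⟦ mem S x ⟧) ≡ 2 * subsetSize S
  #S≡2*subsetSize = begin
    sum (λ x → ⟦ mem S x ⟧)
      ≡⟨ sum-cong-≗ (λ x → ⟦⟧-split (x ≺ μ x) (mem S x)) ⟩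
    sum (λ x → lower x + ⟦ not (x ≺ μ x) ∧ mem S x ⟧)
      ≡⟨ sum-cong-≗ (λ x → cong (λ b → lower x + ⟦ b ∧ mem S x ⟧) (not-≺ x)) ⟩
    sum (λ x → lower x + upper x)
      ≡⟨ ∑-distrib-+ lower upper ⟩
    sum lower + sum upper
      ≡⟨ cong (sum lower +_) sum-upper≡sum-lower ⟩
    sum lower + sum lower
      ≡⟨ cong (sum lower +_) (≡.sym (ℕP.+-identityʳ (sum lower))) ⟩
    2 * sum lower
      ≡⟨ cong (2 *_) (≡.sym subsetSize≡sum-lower) ⟩
    2 * subsetSize S
      ∎
    where
    open ≡-Reasoning
    _≺_ : Fin m → Fin m → Bool
    x ≺ y = does (toℕ x ℕP.<? toℕ y)
    lower upper : Fin m → ℕ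
    lower x = ⟦ x ≺ μ x ∧ mem S x ⟧
    upper x = ⟦ μ x ≺ x ∧ mem S x ⟧
    not-≺ : ∀ x → not (x ≺ μ x) ≡ (μ x ≺ x)
    not-≺ x with ℕP.<-cmp (toℕ x) (toℕ (μ x))
    ... | tri< x<μx _ μx≮x
      rewrite dec-true (toℕ x ℕP.<? toℕ (μ x)) x<μx | dec-false (toℕ (μ x) ℕP.<? toℕ x) μx≮x = refl
    ... | tri> x≮μx _ μx<x
      rewrite dec-false (toℕ x ℕP.<? toℕ (μ x)) x≮μx | dec-true (toℕ (μ x) ℕP.<? toℕ x) μx<x = refl
    ... | tri≈ _ x≡μx _ = ⊥-elim (noFix M x (≡.sym (FinP.toℕ-injective x≡μx)))
    sum-upper≡sum-lower : sum upper ≡ sum lower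
    sum-upper≡sum-lower = ≡.trans (sum-permute upper matePermutation)
      (sum-cong-≗ (λ x → cong₂ (λ y s → ⟦ y ≺ μ x ∧ s ⟧) (invol M x) (≡.sym (closed S x))))
    subsetSize≡sum-lower : subsetSize S ≡ sum lower
    subsetSize≡sum-lower = ≡.trans
      (length-filter-tabulate (λ x → (mem S x Bool.≟ true) ×-dec (toℕ x ℕP.<? toℕ (μ x))) id)
      (sum-cong-≗ (λ x → ≡.trans (cong (λ b → ⟦ b ∧ x ≺ μ x ⟧) (does-≟-true (mem S x)))
                                 (cong ⟦_⟧ (BoolP.∧-comm (mem S x) _))))

  #freeU+subsetSize≡#U : #freeU + subsetSize S ≡ #U
  #freeU+subsetSize≡#U = ℕP.*-cancelˡ-≡ (#freeU + subsetSize S) #U 2 (begin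
    2 * (#freeU + subsetSize S)            ≡⟨ double-+ #freeU (subsetSize S) ⟩
    #freeU + #freeU + 2 * subsetSize S     ≡⟨ cong₂ _+_ (cong (#freeU +_) #freeU≡#freeV) (≡.sym #S≡2*subsetSize) ⟩
    #freeU + #freeV + sum ⟦mem⟧            ≡⟨ cong (_+ sum ⟦mem⟧) (≡.sym #free≡#freeU+#freeV) ⟩
    sum ⟦free⟧ + sum ⟦mem⟧                  ≡⟨ ≡.sym (∑-distrib-+ ⟦free⟧ ⟦mem⟧) ⟩
    sum (λ x → ⟦free⟧ x + ⟦mem⟧ x)         ≡⟨ sum-cong-≗ (λ x → ≡.trans (ℕP.+-comm (⟦free⟧ x) _) (⟦⟧-+-not (mem S x))) ⟩
    sum {m} (λ _ → 1)                      ≡⟨ sum-one ⟩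
    m                                      ≡⟨ ≡.sym 2*#U≡m ⟩
    2 * #U                                 ∎)
    where
    open ≡-Reasoning
    ⟦free⟧ ⟦mem⟧ : Fin m → ℕ
    ⟦free⟧ x = ⟦ free x ⟧
    ⟦mem⟧ x = ⟦ mem S x ⟧
    double-+ : ∀ a b → 2 * (a + b) ≡ a + a + 2 * b
    double-+ = solve-∀

  #U≡half : ∀ n → m ≡ n + n → #U ≡ n
  #U≡half n m≡n+n =
    ℕP.*-cancelˡ-≡ #U n 2 (≡.trans 2*#U≡m (≡.trans m≡n+n (cong (n +_) (≡.sym (ℕP.+-identityʳ n)))))

  #freeU≡#U∸subsetSize : #freeU ≡ #U ∸ subsetSize S
  #freeU≡#U∸subsetSize =
    ≡.trans (≡.sym (ℕP.m+n∸n≡m #freeU (subsetSize S))) (cong (_∸ subsetSize S) #freeU+subsetSize≡#U)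

  forcedᵁ : Fin m → Bool
  forcedᵁ x = colour x ∧ mem S x

  #forcedU : ℕ
  #forcedU = sum λ x → ⟦ forcedᵁ x ⟧

  #U≡#freeU+#forcedU : #U ≡ #freeU + #forcedU
  #U≡#freeU+#forcedU = ≡.trans (sum-cong-≗ (λ x → split (colour x) (mem S x)))
                               (∑-distrib-+ (λ x → ⟦ colour x ∧ free x ⟧) (λ x → ⟦ colour x ∧ mem S x ⟧))
    where
    split : ∀ c s → ⟦ c ⟧ ≡ ⟦ c ∧ not s ⟧ + ⟦ c ∧ s ⟧
    split false s = refl
    split true true = refl
    split true false = refl

  open Balanced #U≡#V #freeU≡#freeV public

  freeᵁ⇒∈U : ∀ {x} → freeᵁ x ≡ true → colour x ≡ true
  freeᵁ⇒∈U {x} x∈freeᵁ = proj₁ (∧-elim (colour x) x∈freeᵁ)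

  freeᵁ⇒free : ∀ {x} → freeᵁ x ≡ true → free x ≡ true
  freeᵁ⇒free {x} x∈freeᵁ = proj₂ (∧-elim (colour x) x∈freeᵁ)

  module Extremal (tight : ∀ x y → load x y ≡ capacity x y) where

    tight-pair : ∀ {x y} → colour x ≡ colour y → x ≢ y → ⟦ arc x y ⟧ + ⟦ arc y x ⟧ + ⟦ free x ∧ free y ∧ true ⟧ ≡ 2
    tight-pair {x} {y} cx≡cy x≢y = begin
      ⟦ arc x y ⟧ + ⟦ arc y x ⟧ + ⟦ free x ∧ free y ∧ true ⟧
        ≡⟨ cong (λ s → ⟦ arc x y ⟧ + ⟦ arc y x ⟧ + ⟦ free x ∧ free y ∧ s ⟧) (≡.sym same) ⟩
      load x y                ≡⟨ tight x y ⟩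
      capacity x y            ≡⟨ capacity-≢ x≢y ⟩
      2 * ⟦ sameColour x y ⟧  ≡⟨ cong (λ s → 2 * ⟦ s ⟧) same ⟩
      2                       ∎
      where
      open ≡-Reasoning
      same = sameColour-≡ cx≡cy

    arc-unless-both-free : ∀ {x y} → colour x ≡ colour y → (free x ∧ free y) ≡ false → arc x y ≡ true
    arc-unless-both-free {x} {y} cx≡cy not-both with x FinP.≟ y
    ... | yes refl = arc-refl x
    ... | no x≢y = exactly-two-of-two (arc x y) (arc y x)
      (subst (λ b → ⟦ arc x y ⟧ + ⟦ arc y x ⟧ + ⟦ b ⟧ ≡ 2)
             (≡.trans (cong (free x ∧_) (BoolP.∧-identityʳ (free y))) not-both) (tight-pair cx≡cy x≢y))

    tournament : ∀ {x y} → freeᵁ x ≡ true → freeᵁ y ≡ true → x ≢ y → arc x y ≡ not (arc y x)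
    tournament {x} {y} x∈freeᵁ y∈freeᵁ x≢y = exactly-one-of-two (arc x y) (arc y x)
      (subst (λ b → ⟦ arc x y ⟧ + ⟦ arc y x ⟧ + ⟦ b ⟧ ≡ 2)
             (∧-intro (freeᵁ⇒free x∈freeᵁ) (∧-intro (freeᵁ⇒free y∈freeᵁ) refl))
             (tight-pair (≡.trans (freeᵁ⇒∈U x∈freeᵁ) (≡.sym (freeᵁ⇒∈U y∈freeᵁ))) x≢y))

    arc-trans : ∀ {x y z} → freeᵁ x ≡ true → freeᵁ y ≡ true → freeᵁ z ≡ true →
                arc x y ≡ true → arc y z ≡ true → arc x z ≡ true
    arc-trans {x} {y} {z} x∈freeᵁ y∈freeᵁ z∈freeᵁ x→y y→z with x FinP.≟ y | y FinP.≟ z | z FinP.≟ x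
    ... | yes refl | _ | _ = y→z
    ... | no _ | yes refl | _ = x→y
    ... | no _ | no _ | yes refl = arc-refl z
    ... | no x≢y | no y≢z | no z≢x with arc x z in x→z
    ...   | true = refl
    ...   | false = ⊥-elim (no-3-cycleᵁ x∈freeᵁ y∈freeᵁ z∈freeᵁ x≢y y≢z z≢x x→y y→z
                             (≡.trans (tournament z∈freeᵁ x∈freeᵁ z≢x) (cong not x→z)))

    rank : Fin m → ℕ
    rank x = sum λ z → ⟦ freeᵁ z ∧ not (arc z x) ⟧

    rank<#freeU : ∀ {x} → freeᵁ x ≡ true → rank x < #freeU
    rank<#freeU {x} x∈freeᵁ = sum-mono-< (λ z → ⟦∧⟧≤⟦⟧ (freeᵁ z) _) x (⟦∧⟧<⟦⟧ x∈freeᵁ (cong not (arc-refl x)))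

    rank-mono : ∀ {x y} → freeᵁ x ≡ true → freeᵁ y ≡ true → x ≢ y → arc x y ≡ true → rank y < rank x
    rank-mono {x} {y} x∈freeᵁ y∈freeᵁ x≢y x→y = sum-mono-< (λ z → ⟦⟧-mono (step z)) y
      (⟦∧⟧<⟦∧⟧ y∈freeᵁ (cong not (arc-refl y)) (≡.trans (cong not (tournament y∈freeᵁ x∈freeᵁ (≡.≢-sym x≢y)))
                                                    (cong (not ∘ not) x→y)))
      where
      step : ∀ z → (freeᵁ z ∧ not (arc z y)) ≡ true → (freeᵁ z ∧ not (arc z x)) ≡ true
      step z z∈freeᵁ∧z↛y with ∧-elim (freeᵁ z) z∈freeᵁ∧z↛y
      ... | z∈freeᵁ , z↛y with arc z x in z→x
      ...   | true = ⊥-elim (BoolP.not-¬ (arc-trans z∈freeᵁ x∈freeᵁ y∈freeᵁ z→x x→y) (BoolP.not-injective z↛y))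
      ...   | false = ∧-intro z∈freeᵁ refl

    rank-injective : ∀ {x y} → freeᵁ x ≡ true → freeᵁ y ≡ true → rank x ≡ rank y → x ≡ y
    rank-injective {x} {y} x∈freeᵁ y∈freeᵁ rx≡ry with x FinP.≟ y
    ... | yes x≡y = x≡y
    ... | no x≢y with arc x y in x→y
    ...   | true = ⊥-elim (ℕP.<-irrefl (≡.sym rx≡ry) (rank-mono x∈freeᵁ y∈freeᵁ x≢y x→y))
    ...   | false = ⊥-elim (ℕP.<-irrefl rx≡ry
                      (rank-mono y∈freeᵁ x∈freeᵁ (≡.≢-sym x≢y)
                                 (≡.trans (tournament y∈freeᵁ x∈freeᵁ (≡.≢-sym x≢y)) (cong not x→y))))

    forcedRank : Fin m → ℕ
    forcedRank x = sum λ z → ⟦ forcedᵁ z ∧ (toℕ z <ᵇ toℕ x) ⟧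

    forcedRank<#forcedU : ∀ {x} → forcedᵁ x ≡ true → forcedRank x < #forcedU
    forcedRank<#forcedU {x} x∈forcedᵁ =
      sum-mono-< (λ z → ⟦∧⟧≤⟦⟧ (forcedᵁ z) _) x (⟦∧⟧<⟦⟧ x∈forcedᵁ (<ᵇ-false {toℕ x} (ℕP.<-irrefl refl)))

    forcedRank-mono : ∀ {x y} → forcedᵁ x ≡ true → toℕ x < toℕ y → forcedRank x < forcedRank y
    forcedRank-mono {x} {y} x∈forcedᵁ x<y = sum-mono-< (λ z → ⟦⟧-mono (step z)) x
      (⟦∧⟧<⟦∧⟧ x∈forcedᵁ (<ᵇ-false {toℕ x} (ℕP.<-irrefl refl)) (<ᵇ-true x<y))
      where
      step : ∀ z → (forcedᵁ z ∧ (toℕ z <ᵇ toℕ x)) ≡ true → (forcedᵁ z ∧ (toℕ z <ᵇ toℕ y)) ≡ true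
      step z z∈forcedᵁ∧z<x = let z∈forcedᵁ , z<x = ∧-elim (forcedᵁ z) z∈forcedᵁ∧z<x in
        ∧-intro z∈forcedᵁ (<ᵇ-true (ℕP.<-trans (<ᵇ-true⁻¹ z<x) x<y))

    forcedRank-injective : ∀ {x y} → forcedᵁ x ≡ true → forcedᵁ y ≡ true → forcedRank x ≡ forcedRank y → x ≡ y
    forcedRank-injective {x} {y} x∈forcedᵁ y∈forcedᵁ rx≡ry with ℕP.<-cmp (toℕ x) (toℕ y)
    ... | tri< x<y _ _ = ⊥-elim (ℕP.<-irrefl rx≡ry (forcedRank-mono x∈forcedᵁ x<y))
    ... | tri≈ _ x≡y _ = FinP.toℕ-injective x≡y
    ... | tri> _ _ y<x = ⊥-elim (ℕP.<-irrefl (≡.sym rx≡ry) (forcedRank-mono y∈forcedᵁ y<x))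

    index : Fin m → ℕ
    index x = if free x then rank x else #freeU + forcedRank x

    index-free : ∀ {x} → free x ≡ true → index x ≡ rank x
    index-free fx rewrite fx = refl

    index-forced : ∀ {x} → free x ≡ false → index x ≡ #freeU + forcedRank x
    index-forced fx rewrite fx = refl

    ∈forcedᵁ : ∀ {x} → colour x ≡ true → free x ≡ false → forcedᵁ x ≡ true
    ∈forcedᵁ x∈U fx = ∧-intro x∈U (BoolP.not-injective fx)

    index<#U : ∀ {x} → colour x ≡ true → index x < #U
    index<#U {x} x∈U = subst (index x <_) (≡.sym #U≡#freeU+#forcedU) (by-cases (free x)
      (λ fx → subst (_< #freeU + #forcedU) (≡.sym (index-free fx))
                    (ℕP.<-≤-trans (rank<#freeU (∧-intro x∈U fx)) (ℕP.m≤m+n #freeU #forcedU)))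
      (λ fx → subst (_< #freeU + #forcedU) (≡.sym (index-forced fx))
                    (ℕP.+-monoʳ-< #freeU (forcedRank<#forcedU (∈forcedᵁ x∈U fx)))))

    free<forced : ∀ {x y} → colour x ≡ true → free x ≡ true → free y ≡ false → index x < index y
    free<forced {x} {y} x∈U fx fy = subst₂ _<_ (≡.sym (index-free fx)) (≡.sym (index-forced fy))
      (ℕP.<-≤-trans (rank<#freeU (∧-intro x∈U fx)) (ℕP.m≤m+n #freeU (forcedRank y)))

    index-injective : ∀ {x y} → colour x ≡ true → colour y ≡ true → index x ≡ index y → x ≡ y
    index-injective {x} {y} x∈U y∈U ix≡iy = by-cases (free x)
      (λ fx → by-cases (free y)
        (λ fy → rank-injective (∧-intro x∈U fx) (∧-intro y∈U fy)
                  (≡.trans (≡.sym (index-free fx)) (≡.trans ix≡iy (index-free fy))))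
        (λ fy → ⊥-elim (ℕP.<-irrefl ix≡iy (free<forced x∈U fx fy))))
      (λ fx → by-cases (free y)
        (λ fy → ⊥-elim (ℕP.<-irrefl (≡.sym ix≡iy) (free<forced y∈U fy fx)))
        (λ fy → forcedRank-injective (∈forcedᵁ x∈U fx) (∈forcedᵁ y∈U fy)
                  (ℕP.+-cancelˡ-≡ #freeU _ _ (≡.trans (≡.sym (index-forced fx)) (≡.trans ix≡iy (index-forced fy))))))

    arc-index : ∀ {x y} → colour x ≡ true → colour y ≡ true → arc x y ≡ staircase #freeU (index x) (index y)
    arc-index {x} {y} x∈U y∈U = by-cases (free y) (λ fy → by-cases (free x) (both-free fy) (x-forced fy)) y-forced
      where
      cx≡cy : colour x ≡ colour y
      cx≡cy = ≡.trans x∈U (≡.sym y∈U)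
      y-forced : free y ≡ false → arc x y ≡ staircase #freeU (index x) (index y)
      y-forced fy = ≡.trans (arc-unless-both-free cx≡cy (≡.trans (cong (free x ∧_) fy) (BoolP.∧-zeroʳ (free x))))
        (≡.sym (staircase-≥ (subst (#freeU ≤_) (≡.sym (index-forced fy)) (ℕP.m≤m+n #freeU (forcedRank y)))))
      x-forced : free y ≡ true → free x ≡ false → arc x y ≡ staircase #freeU (index x) (index y)
      x-forced fy fx = ≡.trans (arc-unless-both-free cx≡cy (cong (_∧ free y) fx))
                               (≡.sym (staircase-≤ {#freeU} (ℕP.<⇒≤ (free<forced y∈U fy fx))))
      both-free : free y ≡ true → free x ≡ true → arc x y ≡ staircase #freeU (index x) (index y)
      both-free fy fx =
        subst₂ (λ i j → arc x y ≡ staircase #freeU i j) (≡.sym (index-free fx)) (≡.sym (index-free fy)) ranks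
        where
        x∈freeᵁ = ∧-intro x∈U fx
        y∈freeᵁ = ∧-intro y∈U fy
        ranks : arc x y ≡ staircase #freeU (rank x) (rank y)
        ranks with x FinP.≟ y
        ... | yes refl = ≡.trans (arc-refl x) (≡.sym (staircase-≤ {#freeU} ℕP.≤-refl))
        ... | no x≢y with arc x y in x→y
        ...   | true = ≡.sym (staircase-≤ {#freeU} (ℕP.<⇒≤ (rank-mono x∈freeᵁ y∈freeᵁ x≢y x→y)))
        ...   | false = ≡.sym (staircase-< (rank-mono y∈freeᵁ x∈freeᵁ (≡.≢-sym x≢y) y→x) (rank<#freeU y∈freeᵁ))
          where y→x = ≡.trans (tournament y∈freeᵁ x∈freeᵁ (≡.≢-sym x≢y)) (cong not x→y)

theorem2p3 : (n k : ℕ) (G : Graph (n + n)) → IsBipartite G → PerfectMatching G →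
    k < n → ForcingNumberIs G k →
    (2 * edgeCount G ≤ (n ∸ k) * (n + k + 1) + 2 * (n * k))
    × ((2 * edgeCount G ≡ (n ∸ k) * (n + k + 1) + 2 * (n * k)) ⇔ Isomorphic G (H n k))
theorem2p3 n k G (colour , proper) _ k<n ((M , S , forcing , |S|≡k) , _) =
  edge-bound , mk⇔ extremal⇒≅H ≅H⇒extremal
  where
  open Forcing G colour proper M S forcing
  #U≡n = #U≡half n refl
  #freeU≡n∸k = ≡.trans #freeU≡#U∸subsetSize (cong₂ _∸_ #U≡n |S|≡k)

  edges : 2 * edgeCount G + (n ∸ k) * (n ∸ k) ≡ adjacencySum G + #freeU * #freeU
  edges = cong₂ (λ e p → e + p * p) (2*edgeCount≡adjacencySum G) (≡.sym #freeU≡n∸k)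

  bound : (n ∸ k) * (n + k + 1) + 2 * (n * k) + (n ∸ k) * (n ∸ k) ≡ 2 * (#U * #U) + #freeU
  bound = ≡.trans (bound+square n k (ℕP.<⇒≤ k<n)) (cong₂ (λ u p → 2 * (u * u) + p) (≡.sym #U≡n) (≡.sym #freeU≡n∸k))

  edge-bound : 2 * edgeCount G ≤ (n ∸ k) * (n + k + 1) + 2 * (n * k)
  edge-bound = ℕP.+-cancelʳ-≤ _ _ _ (subst₂ _≤_ (≡.sym edges) (≡.sym bound) (adjacencySum-bound load≤capacity))

  extremal⇒≅H : 2 * edgeCount G ≡ (n ∸ k) * (n + k + 1) + 2 * (n * k) → Isomorphic G (H n k)
  extremal⇒≅H extremal = Recognition.≅H n k G colour proper M colour-μ index
    (λ x∈U → subst (index _ <_) #U≡n (index<#U x∈U)) index-injective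
    (λ {x} {y} x∈U y∈U → ≡.trans (arc-index x∈U y∈U) (cong (λ L → staircase L (index x) (index y)) #freeU≡n∸k))
    where
    open Extremal (tight⇒load≡capacity load≤capacity
                    (≡.trans (≡.sym edges) (≡.trans (cong (_+ (n ∸ k) * (n ∸ k)) extremal) bound)))

  ≅H⇒extremal : Isomorphic G (H n k) → 2 * edgeCount G ≡ (n ∸ k) * (n + k + 1) + 2 * (n * k)
  ≅H⇒extremal G≅H = ≡.trans (2*edgeCount≡adjacencySum G)
                             (≡.trans (adjacencySum-cong G (H n k) G≅H) (HCount.adjacencySum-H n k (ℕP.<⇒≤ k<n)))
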